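{- Let $n,k,m$ be positive integers, and let $r_0<r_1<\dots<r_{k-1}$ and $s_0<s_1<\dots<s_{k-1}$ be integers with $1\le r_i,s_i\le k+m$ for all $i$. Let $\bar r_0<\dots<\bar r_{m-1}$ be the elements of $\{1,\dots,k+m\}\setminus\{r_0,\dots,r_{k-1}\}$ and $\bar s_0<\dots<\bar s_{m-1}$ those of $\{1,\dots,k+m\}\setminus\{s_0,\dots,s_{k-1}\}$. Then $$\det\left(C_{2n-1}^{(2k+2m-1)}(2r_i-2\to 2s_j-1)\right)_{0\le i,j\le k-1}=(-1)^{\sum_{i=0}^{m-1}(\bar r_i+\bar s_i)}\det\left(C_{ -2n+1}^{(2k+2m-1)}(2\bar r_i-2\to 2\bar s_j-1)\right)_{0\le i,j\le m-1}.$$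
   Context: An up-down path is a lattice path with steps $(1,1)$ and $(1,-1)$. For an integer $K\ge0$, integers $0\le r,s\le K$ and $N\ge0$, $C_N^{(K)}(r\to s)$ denotes the number of up-down paths from $(0,r)$ to $(N,s)$ that never pass below the $x$-axis and never pass above the line $y=K$. For $K$ odd and fixed $r,s$, the generating function $f(x)=\sum_{N\ge0}C_N^{(K)}(r\to s)x^N$ is a rational function $p(x)/q(x)$ with $q(0)\ne0$ and $\deg p<\deg q$; the values at negative lengths are defined by $\sum_{N\ge1}C_{ -N}^{(K)}(r\to s)x^N=-f(1/x)$ (equivalently, the sequence is extended to all $N\in\mathbb Z$ so that the linear recurrence with constant coefficients given by $q$ holds for all $N$). -}

module Defs where

open import Data.Nat as ℕ using (ℕ; zero; suc; _≤ᵇ_; _≡ᵇ_)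
open import Data.Bool using (Bool; true; false; _∧_; if_then_else_)
open import Data.List using (List; []; _∷_; _++_; map)
open import Data.Fin using (Fin; zero; suc; toℕ; fromℕ; punchIn)
open import Data.Integer as ℤ using (ℤ; +_; -_; _-_)
open import Relation.Binary.PropositionalEquality using (_≡_; _≢_)
open import Data.Product using (Σ; _×_)

data Step : Set where
  up down : Step

allPaths : ℕ → List (List Step)
allPaths zero = [] ∷ []
allPaths (suc N) = map (up ∷_) (allPaths N) ++ map (down ∷_) (allPaths N)

-- Starting at height h (h already known to lie in [0,K]), does the path
-- stay within 0 ≤ y ≤ K and end at height s?
staysAndEnds : ℕ → ℕ → List Step → ℕ → Bool
staysAndEnds K h [] s = h ≡ᵇ s
staysAndEnds K h (up ∷ ps) s = (suc h ≤ᵇ K) ∧ staysAndEnds K (suc h) ps s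
staysAndEnds K zero (down ∷ ps) s = false
staysAndEnds K (suc h) (down ∷ ps) s = staysAndEnds K h ps s

isPath : (K r s : ℕ) → List Step → Bool
isPath K r s ps = (r ≤ᵇ K) ∧ staysAndEnds K r ps s

countTrue : {A : Set} → (A → Bool) → List A → ℕ
countTrue p [] = 0
countTrue p (x ∷ xs) = (if p x then 1 else 0) ℕ.+ countTrue p xs

C : (K N r s : ℕ) → ℕ
C K N r s = countTrue (isPath K r s) (allPaths N)

Σℤ : (n : ℕ) → (Fin n → ℤ) → ℤ
Σℤ zero f = + 0
Σℤ (suc n) f = f zero ℤ.+ Σℤ n (λ i → f (suc i))

Σℕ : (n : ℕ) → (Fin n → ℕ) → ℕ
Σℕ zero f = 0
Σℕ (suc n) f = f zero ℕ.+ Σℕ n (λ i → f (suc i))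

det : (n : ℕ) → (Fin n → Fin n → ℤ) → ℤ
det zero M = + 1
det (suc n) M =
  Σℤ (suc n) (λ j → ((- + 1) ℤ.^ toℕ j) ℤ.* (M zero j ℤ.* det n (λ a b → M (suc a) (punchIn j b))))

-- c : ℤ → ℤ is the extension to all integer lengths of N ↦ C_N^{(K)}(r→s):
-- it agrees with the path count for N ≥ 0, and there is a polynomial
-- q(x) = q_0 + q_1 x + … + q_d x^d with q(0) ≠ 0 and deg q = d (q_d ≠ 0)
-- such that the constant-coefficient linear recurrence given by q holds for
-- all N ∈ ℤ.  (Restricted to N ≥ 0 with c(N)=0 for N<0 implicitly at the
-- power-series level, this is exactly f = p/q with deg p < deg q; the
-- two-sided recurrence is the paper's extension to negative lengths.)
IsExtension : (K r s : ℕ) → (ℤ → ℤ) → Set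
IsExtension K r s c =
  ((N : ℕ) → c (+ N) ≡ + C K N r s) ×
  Σ ℕ (λ d → Σ (Fin (suc d) → ℤ) (λ q →
    (q zero ≢ + 0) × (q (fromℕ d) ≢ + 0) ×
    ((N : ℤ) → Σℤ (suc d) (λ i → q i ℤ.* c (N - + toℕ i)) ≡ + 0)))

StrictlyIncreasing : {n : ℕ} → (Fin n → ℕ) → Set
StrictlyIncreasing {n} f = (i j : Fin n) → toℕ i ℕ.< toℕ j → f i ℕ.< f j

module Submission where

-- Index rows by the even heights 2x − 2 and columns by the odd heights 2y − 1 (or the even
-- heights 2y − 2) of the strip 0 ≤ h ≤ 2M − 1, M = k + m.  Starting from the identity, the grid of
-- path counts of length 2n − 1 is reached by steps "add column p to the adjacent column q", each
-- step of the walk between even and odd heights being a block of such operations.  An operation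
-- A ↦ A (I + E_pq) is paired with H ↦ H (I + E_pq)⁻ᵀ on a second grid, and the pair preserves
-- Jacobi's relation det A[r, s] = (−1)^Σ(r̄ + s̄) det H[r̄, s̄] between complementary minors, which
-- holds for A = H = I.  On the second grid the operations undo steps of the walk; since the extension
-- of the counts to negative lengths satisfies the same linear recurrences, the last-step identities
-- hold for all lengths, and the second grid becomes the grid of counts at length −(2n − 1).

open import Data.Bool using (Bool; true; false; _∧_; if_then_else_; T)
open import Data.Bool.Properties using (T-≡)
open import Data.Empty using (⊥-elim)
open import Data.Fin using (Fin; zero; suc; toℕ; fromℕ; fromℕ<; punchIn; punchOut; inject₁)
open import Data.Fin.Induction using () renaming (<-wellFounded to <-wellFounded-Fin)
open import Data.Fin.Properties using (any?; toℕ-injective; suc-injective; punchIn-injective; punchInᵢ≢i; punchIn-punchOut; toℕ-inject₁; toℕ-fromℕ; toℕ-fromℕ<; toℕ<n)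
open import Data.Integer as ℤ using (ℤ; +_; -_; _+_; _*_; _-_; -[1+_])
import Data.Integer.Properties as ℤP
open import Data.Integer.Tactic.RingSolver using (solve-∀)
open import Data.List using (List; []; _∷_; _++_; map)
open import Data.Nat as ℕ using (ℕ; zero; suc; z≤n; s≤s; _≤_; _<_; _∸_; _≡ᵇ_; _≤ᵇ_)
import Data.Nat.Properties as ℕP
import Data.Nat.Tactic.RingSolver as ℕSolver
open import Data.Product using (Σ; ∃; _×_; _,_; proj₁; proj₂)
open import Data.Sum using (_⊎_; inj₁; inj₂)
open import Data.Unit using (⊤; tt)
open import Data.Vec.Functional using (updateAt)
open import Data.Vec.Functional.Properties using (updateAt-updates; updateAt-minimal)
open import Function using (const; _$_)
open import Function.Bundles using (_⇔_; mk⇔; Equivalence)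
open import Induction.WellFounded using (module All)
open import Relation.Binary using (tri<; tri≈; tri>)
open import Relation.Binary.PropositionalEquality
open import Relation.Nullary using (¬_; yes; no)
open import Relation.Nullary.Decidable using (¬?; decidable-stable)

open import Defs

Σℤ-cong : ∀ n {f g : Fin n → ℤ} → (∀ i → f i ≡ g i) → Σℤ n f ≡ Σℤ n g
Σℤ-cong zero    f≗g = refl
Σℤ-cong (suc n) f≗g = cong₂ _+_ (f≗g zero) (Σℤ-cong n (λ i → f≗g (suc i)))

Σℤ-zero : ∀ n {f : Fin n → ℤ} → (∀ i → f i ≡ + 0) → Σℤ n f ≡ + 0
Σℤ-zero zero    f≗0 = refl
Σℤ-zero (suc n) f≗0 rewrite f≗0 zero | Σℤ-zero n (λ i → f≗0 (suc i)) = refl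

Σℤ-distrib-+ : ∀ n (f g : Fin n → ℤ) → Σℤ n (λ i → f i + g i) ≡ Σℤ n f + Σℤ n g
Σℤ-distrib-+ zero    f g = refl
Σℤ-distrib-+ (suc n) f g rewrite Σℤ-distrib-+ n (λ i → f (suc i)) (λ i → g (suc i)) =
  interchange (f zero) (g zero) (Σℤ n (λ i → f (suc i))) (Σℤ n (λ i → g (suc i)))
  where interchange : ∀ a b c d → (a + b) + (c + d) ≡ (a + c) + (b + d)
        interchange = solve-∀

Σℤ-*ˡ : ∀ n a (f : Fin n → ℤ) → Σℤ n (λ i → a * f i) ≡ a * Σℤ n f
Σℤ-*ˡ zero    a f = sym (ℤP.*-zeroʳ a)
Σℤ-*ˡ (suc n) a f rewrite Σℤ-*ˡ n a (λ i → f (suc i)) = sym (ℤP.*-distribˡ-+ a (f zero) _)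

Σℤ-swap : ∀ n m (f : Fin n → Fin m → ℤ) →
          Σℤ n (λ i → Σℤ m (f i)) ≡ Σℤ m (λ j → Σℤ n (λ i → f i j))
Σℤ-swap zero    m f = sym (Σℤ-zero m (λ _ → refl))
Σℤ-swap (suc n) m f rewrite Σℤ-swap n m (λ i → f (suc i)) =
  sym (Σℤ-distrib-+ m (f zero) (λ j → Σℤ n (λ i → f (suc i) j)))

Σℤ-last : ∀ n (f : Fin (suc n) → ℤ) → Σℤ (suc n) f ≡ Σℤ n (λ i → f (inject₁ i)) + f (fromℕ n)
Σℤ-last zero    f = ℤP.+-comm (f zero) (+ 0)
Σℤ-last (suc n) f rewrite Σℤ-last n (λ i → f (suc i)) = sym (ℤP.+-assoc (f zero) _ _)

Σℤ-pair-cancel : ∀ n c (f : Fin n → ℤ) → suc c < n →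
                 (∀ t → toℕ t ≢ c → toℕ t ≢ suc c → f t ≡ + 0) →
                 (∀ t t′ → toℕ t ≡ c → toℕ t′ ≡ suc c → f t + f t′ ≡ + 0) →
                 Σℤ n f ≡ + 0
Σℤ-pair-cancel (suc (suc n)) zero f _ others pair
  rewrite Σℤ-zero n {λ i → f (suc (suc i))} (λ i → others (suc (suc i)) (λ ()) (λ ())) =
  trans (sym (ℤP.+-assoc (f zero) (f (suc zero)) (+ 0)))
        (trans (ℤP.+-identityʳ _) (pair zero (suc zero) refl refl))
Σℤ-pair-cancel (suc n) (suc c) f (s≤s c<n) others pair rewrite others zero (λ ()) (λ ()) =
  trans (ℤP.+-identityˡ _)
        (Σℤ-pair-cancel n c (λ i → f (suc i)) c<n
          (λ t t≢c t≢1+c → others (suc t) (λ e → t≢c (ℕP.suc-injective e)) (λ e → t≢1+c (ℕP.suc-injective e)))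
          (λ t t′ t≡c t′≡1+c → pair (suc t) (suc t′) (cong suc t≡c) (cong suc t′≡1+c)))

Matrix : ℕ → Set
Matrix n = Fin n → Fin n → ℤ

sign : ℕ → ℤ
sign k = (- + 1) ℤ.^ k

minor : ∀ {n} → Matrix (suc n) → Fin (suc n) → Matrix n
minor M j a b = M (suc a) (punchIn j b)

det-cong : ∀ n {M N : Matrix n} → (∀ i j → M i j ≡ N i j) → det n M ≡ det n N
det-cong zero    M≗N = refl
det-cong (suc n) M≗N = Σℤ-cong (suc n) λ j →
  cong₂ (λ x y → sign (toℕ j) * (x * y)) (M≗N zero j) (det-cong n (λ a b → M≗N (suc a) (punchIn j b)))

det-linear-column : ∀ n (c : Fin n) (l : ℤ) (M M′ M″ : Matrix n) →
                    (∀ x → M x c ≡ M′ x c + l * M″ x c) →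
                    (∀ x y → y ≢ c → M x y ≡ M′ x y) →
                    (∀ x y → y ≢ c → M x y ≡ M″ x y) →
                    det n M ≡ det n M′ + l * det n M″
det-linear-column (suc n) c l M M′ M″ atC offC′ offC″ =
  begin
    Σℤ (suc n) (term M)                                  ≡⟨ Σℤ-cong (suc n) expand ⟩
    Σℤ (suc n) (λ j → term M′ j + l * term M″ j)         ≡⟨ Σℤ-distrib-+ (suc n) (term M′) (λ j → l * term M″ j) ⟩
    Σℤ (suc n) (term M′) + Σℤ (suc n) (λ j → l * term M″ j) ≡⟨ cong (λ z → Σℤ (suc n) (term M′) + z) (Σℤ-*ˡ (suc n) l (term M″)) ⟩
    Σℤ (suc n) (term M′) + l * Σℤ (suc n) (term M″)      ∎
  where
  open ≡-Reasoning
  term : Matrix (suc n) → Fin (suc n) → ℤ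
  term A j = sign (toℕ j) * (A zero j * det n (minor A j))
  expand : ∀ j → term M j ≡ term M′ j + l * term M″ j
  expand j with j Data.Fin.≟ c
  ... | yes refl
    rewrite atC zero
          | det-cong n {minor M j} {minor M′ j} (λ a b → offC′ (suc a) (punchIn j b) (punchInᵢ≢i j b))
          | det-cong n {minor M″ j} {minor M′ j}
              (λ a b → trans (sym (offC″ (suc a) (punchIn j b) (punchInᵢ≢i j b))) (offC′ (suc a) (punchIn j b) (punchInᵢ≢i j b))) =
    distrib (sign (toℕ j)) (M′ zero j) (M″ zero j) l (det n (minor M′ j))
    where distrib : ∀ s a b l d → s * ((a + l * b) * d) ≡ s * (a * d) + l * (s * (b * d))
          distrib = solve-∀
  ... | no j≢c
    rewrite offC′ zero j j≢c
          | sym (trans (sym (offC′ zero j j≢c)) (offC″ zero j j≢c))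
          | det-linear-column n (punchOut j≢c) l (minor M j) (minor M′ j) (minor M″ j)
              (λ x → subst (λ z → M (suc x) z ≡ M′ (suc x) z + l * M″ (suc x) z) (sym (punchIn-punchOut j≢c)) (atC (suc x)))
              (λ x y y≢ → offC′ (suc x) (punchIn j y) (λ e → y≢ (punchIn-injective j y _ (trans e (sym (punchIn-punchOut j≢c))))))
              (λ x y y≢ → offC″ (suc x) (punchIn j y) (λ e → y≢ (punchIn-injective j y _ (trans e (sym (punchIn-punchOut j≢c)))))) =
    distrib (sign (toℕ j)) (M′ zero j) (det n (minor M′ j)) (det n (minor M″ j)) l
    where distrib : ∀ s a d e l → s * (a * (d + l * e)) ≡ s * (a * d) + l * (s * (a * e))
          distrib = solve-∀

det-zero-row : ∀ n (M : Matrix n) (i : Fin n) → (∀ j → M i j ≡ + 0) → det n M ≡ + 0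
det-zero-row (suc n) M zero    row≗0 = Σℤ-zero (suc n) λ j →
  trans (cong (λ x → sign (toℕ j) * (x * det n (minor M j))) (row≗0 j)) (ℤP.*-zeroʳ (sign (toℕ j)))
det-zero-row (suc n) M (suc i) row≗0 = Σℤ-zero (suc n) λ j →
  trans (cong (λ x → sign (toℕ j) * (M zero j * x)) (det-zero-row n (minor M j) i (λ b → row≗0 (punchIn j b))))
        (trans (cong (sign (toℕ j) *_) (ℤP.*-zeroʳ (M zero j))) (ℤP.*-zeroʳ (sign (toℕ j))))

-- Linearity in column c, with M written as M + 1 * M, gives det M = det M + det M.
det-zero-column : ∀ n (M : Matrix n) (c : Fin n) → (∀ i → M i c ≡ + 0) → det n M ≡ + 0
det-zero-column n M c col≗0 = x≡x+x⇒x≡0 (det n M)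
  (det-linear-column n c (+ 1) M M M (λ x → trans (col≗0 x) (sym (cong₂ (λ a b → a + + 1 * b) (col≗0 x) (col≗0 x))))
    (λ _ _ _ → refl) (λ _ _ _ → refl))
  where
  x≡x+x⇒x≡0 : ∀ x → x ≡ x + + 1 * x → x ≡ + 0
  x≡x+x⇒x≡0 x x≡2x = trans (sym (cancel x)) (trans (cong (λ y → y - x) (sym x≡2x)) (ℤP.+-inverseʳ x))
    where cancel : ∀ x → x + + 1 * x - x ≡ x
          cancel = solve-∀

det-identity : ∀ n (M : Matrix n) → (∀ i → M i i ≡ + 1) → (∀ i j → i ≢ j → M i j ≡ + 0) → det n M ≡ + 1
det-identity zero    M diag off = refl
det-identity (suc n) M diag off
  rewrite diag zero
        | det-identity n (minor M zero) (λ i → diag (suc i)) (λ i j i≢j → off (suc i) (suc j) (λ e → i≢j (suc-injective e)))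
        | Σℤ-zero n {λ j → sign (toℕ (suc j)) * (M zero (suc j) * det n (minor M (suc j)))}
            (λ j → trans (cong (λ x → sign (toℕ (suc j)) * (x * det n (minor M (suc j)))) (off zero (suc j) (λ ())))
                         (ℤP.*-zeroʳ (sign (toℕ (suc j))))) = refl

toℕ-punchIn-< : ∀ {n} (t : Fin (suc n)) (a : Fin n) → toℕ a < toℕ t → toℕ (punchIn t a) ≡ toℕ a
toℕ-punchIn-< (suc t) zero    _         = refl
toℕ-punchIn-< (suc t) (suc a) (s≤s a<t) = cong suc (toℕ-punchIn-< t a a<t)

toℕ-punchIn-≥ : ∀ {n} (t : Fin (suc n)) (a : Fin n) → toℕ t ≤ toℕ a → toℕ (punchIn t a) ≡ suc (toℕ a)
toℕ-punchIn-≥ zero    a       _         = refl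
toℕ-punchIn-≥ (suc t) (suc a) (s≤s t≤a) = cong suc (toℕ-punchIn-≥ t a t≤a)

ColumnsEqualAt : ∀ {n} → Matrix n → ℕ → Set
ColumnsEqualAt M c = ∀ x a b → toℕ a ≡ c → toℕ b ≡ suc c → M x a ≡ M x b

minor-columnsEqualAt-below : ∀ {n} (M : Matrix (suc n)) t c → toℕ t ≤ c →
                             ColumnsEqualAt M (suc c) → ColumnsEqualAt (minor M t) c
minor-columnsEqualAt-below M t c t≤c eq x a b a≡c b≡1+c =
  eq (suc x) (punchIn t a) (punchIn t b)
     (trans (toℕ-punchIn-≥ t a (subst (toℕ t ≤_) (sym a≡c) t≤c)) (cong suc a≡c))
     (trans (toℕ-punchIn-≥ t b (subst (toℕ t ≤_) (sym b≡1+c) (ℕP.m≤n⇒m≤1+n t≤c))) (cong suc b≡1+c))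

minor-columnsEqualAt-above : ∀ {n} (M : Matrix (suc n)) t c → suc c < toℕ t →
                             ColumnsEqualAt M c → ColumnsEqualAt (minor M t) c
minor-columnsEqualAt-above M t c 1+c<t eq x a b a≡c b≡1+c =
  eq (suc x) (punchIn t a) (punchIn t b)
     (trans (toℕ-punchIn-< t a (subst (_< toℕ t) (sym a≡c) (ℕP.<-trans (ℕP.n<1+n c) 1+c<t))) a≡c)
     (trans (toℕ-punchIn-< t b (subst (_< toℕ t) (sym b≡1+c) 1+c<t)) b≡1+c)

minor-columnsEqualAt : ∀ {n} (M : Matrix (suc n)) t t′ c → toℕ t ≡ c → toℕ t′ ≡ suc c →
                       ColumnsEqualAt M c → ∀ a b → minor M t a b ≡ minor M t′ a b
minor-columnsEqualAt M t t′ c t≡c t′≡1+c eq a b with ℕP.<-cmp (toℕ b) c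
... | tri< b<c _ _ = cong (M (suc a)) (toℕ-injective
        (trans (toℕ-punchIn-< t b (subst (toℕ b <_) (sym t≡c) b<c))
               (sym (toℕ-punchIn-< t′ b (subst (toℕ b <_) (sym t′≡1+c) (ℕP.m≤n⇒m≤1+n b<c))))))
... | tri≈ _ b≡c _ = sym (eq (suc a) (punchIn t′ b) (punchIn t b)
        (trans (toℕ-punchIn-< t′ b (subst₂ _<_ (sym b≡c) (sym t′≡1+c) (ℕP.n<1+n c))) b≡c)
        (trans (toℕ-punchIn-≥ t b (subst₂ _≤_ (sym t≡c) (sym b≡c) ℕP.≤-refl)) (cong suc b≡c)))
... | tri> _ _ c<b = cong (M (suc a)) (toℕ-injective
        (trans (toℕ-punchIn-≥ t b (subst (_≤ toℕ b) (sym t≡c) (ℕP.<⇒≤ c<b)))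
               (sym (toℕ-punchIn-≥ t′ b (subst (_≤ toℕ b) (sym t′≡1+c) c<b)))))

-- In the expansion along the first row the terms at c and c + 1 cancel (equal minors, opposite
-- signs), and every other minor again has two equal adjacent columns.
mutual
  det-columnsEqualAt : ∀ n (M : Matrix n) c → suc c < n → ColumnsEqualAt M c → det n M ≡ + 0
  det-columnsEqualAt (suc n) M c 1+c<n eq = Σℤ-pair-cancel (suc n) c term 1+c<n vanish cancel
    where
    term : Fin (suc n) → ℤ
    term j = sign (toℕ j) * (M zero j * det n (minor M j))
    term-zero : ∀ j → det n (minor M j) ≡ + 0 → term j ≡ + 0
    term-zero j d≡0 rewrite d≡0 | ℤP.*-zeroʳ (M zero j) = ℤP.*-zeroʳ (sign (toℕ j))
    vanish : ∀ t → toℕ t ≢ c → toℕ t ≢ suc c → term t ≡ + 0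
    vanish t t≢c t≢1+c with ℕP.<-cmp (toℕ t) c
    ... | tri< t<c _ _ = term-zero t (det-minor-below n M t c t<c 1+c<n eq)
    ... | tri≈ _ t≡c _ = ⊥-elim (t≢c t≡c)
    ... | tri> _ _ c<t = term-zero t (det-columnsEqualAt n (minor M t) c
            (ℕP.<-≤-trans 1+c<t (ℕP.≤-pred (toℕ<n t))) (minor-columnsEqualAt-above M t c 1+c<t eq))
      where 1+c<t : suc c < toℕ t
            1+c<t = ℕP.≤∧≢⇒< c<t (λ e → t≢1+c (sym e))
    cancel : ∀ t t′ → toℕ t ≡ c → toℕ t′ ≡ suc c → term t + term t′ ≡ + 0
    cancel t t′ t≡c t′≡1+c
      rewrite t≡c | t′≡1+c
            | sym (eq zero t t′ t≡c t′≡1+c)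
            | det-cong n (λ a b → sym (minor-columnsEqualAt M t t′ c t≡c t′≡1+c eq a b)) =
      opposite-signs (sign c) (M zero t) (det n (minor M t))
      where opposite-signs : ∀ s a d → s * (a * d) + (- + 1 * s) * (a * d) ≡ + 0
            opposite-signs = solve-∀

  det-minor-below : ∀ n (M : Matrix (suc n)) t c → toℕ t < c → suc c < suc n →
                    ColumnsEqualAt M c → det n (minor M t) ≡ + 0
  det-minor-below n M t (suc c) (s≤s t≤c) (s≤s 1+c<n) eq =
    det-columnsEqualAt n (minor M t) c 1+c<n (minor-columnsEqualAt-below M t c t≤c eq)

module _ {n : ℕ} {f : Fin n → ℕ} (f↑ : StrictlyIncreasing f) where

  strictlyIncreasing-injective : ∀ i j → f i ≡ f j → i ≡ j
  strictlyIncreasing-injective i j fi≡fj with ℕP.<-cmp (toℕ i) (toℕ j)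
  ... | tri< i<j _ _ = ⊥-elim (ℕP.<-irrefl fi≡fj (f↑ i j i<j))
  ... | tri≈ _ i≡j _ = toℕ-injective i≡j
  ... | tri> _ _ j<i = ⊥-elim (ℕP.<-irrefl (sym fi≡fj) (f↑ j i j<i))

  strictlyIncreasing-cancel-< : ∀ i j → f i < f j → toℕ i < toℕ j
  strictlyIncreasing-cancel-< i j fi<fj with ℕP.<-cmp (toℕ i) (toℕ j)
  ... | tri< i<j _ _ = i<j
  ... | tri≈ _ i≡j _ = ⊥-elim (ℕP.<-irrefl (cong f (toℕ-injective i≡j)) fi<fj)
  ... | tri> _ _ j<i = ⊥-elim (ℕP.<-asym fi<fj (f↑ j i j<i))

  strictlyIncreasing-mono-≤ : ∀ i j → toℕ i ≤ toℕ j → f i ≤ f j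
  strictlyIncreasing-mono-≤ i j i≤j with ℕP.m≤n⇒m<n∨m≡n i≤j
  ... | inj₁ i<j = ℕP.<⇒≤ (f↑ i j i<j)
  ... | inj₂ i≡j = ℕP.≤-reflexive (cong f (toℕ-injective i≡j))

  strictlyIncreasing-consecutive : ∀ a b → suc (f a) ≡ f b → toℕ b ≡ suc (toℕ a)
  strictlyIncreasing-consecutive a b 1+fa≡fb with ℕP.<-cmp (toℕ b) (suc (toℕ a))
  ... | tri≈ _ b≡1+a _ = b≡1+a
  ... | tri< b<1+a _ _ = ⊥-elim (ℕP.<-irrefl refl (ℕP.<-≤-trans a<b (ℕP.≤-pred b<1+a)))
    where a<b = strictlyIncreasing-cancel-< a b (subst (f a <_) 1+fa≡fb (ℕP.n<1+n (f a)))
  ... | tri> _ _ 1+a<b = ⊥-elim (ℕP.<-irrefl refl (ℕP.<-≤-trans fa<fj (ℕP.≤-pred (subst (f j <_) (sym 1+fa≡fb) fj<fb))))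
    where
    j : Fin n
    j = fromℕ< (ℕP.<-trans 1+a<b (toℕ<n b))
    fa<fj : f a < f j
    fa<fj = f↑ a j (subst (toℕ a <_) (sym (toℕ-fromℕ< _)) (ℕP.n<1+n _))
    fj<fb : f j < f b
    fj<fb = f↑ j b (subst (_< toℕ b) (sym (toℕ-fromℕ< _)) 1+a<b)

agreeBelow⇒≤ : ∀ {n} {f g : Fin n → ℕ} → StrictlyIncreasing f → StrictlyIncreasing g →
               (∀ i → ∃ λ j → f j ≡ g i) →
               ∀ i → (∀ j → toℕ j < toℕ i → f j ≡ g j) → f i ≤ g i
agreeBelow⇒≤ {f = f} {g} f↑ g↑ g⊆f i agree with g⊆f i
... | j , fj≡gi with ℕP.<-cmp (toℕ j) (toℕ i)
... | tri< j<i _ _ = ⊥-elim (ℕP.<-irrefl (cong toℕ (strictlyIncreasing-injective g↑ j i (trans (sym (agree j j<i)) fj≡gi))) j<i)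
... | tri≈ _ j≡i _ = subst (f i ≤_) fj≡gi (strictlyIncreasing-mono-≤ f↑ i j (ℕP.≤-reflexive (sym j≡i)))
... | tri> _ _ i<j = subst (f i ≤_) fj≡gi (strictlyIncreasing-mono-≤ f↑ i j (ℕP.<⇒≤ i<j))

strictlyIncreasing-sameImage : ∀ {n} {f g : Fin n → ℕ} → StrictlyIncreasing f → StrictlyIncreasing g →
                               (∀ i → ∃ λ j → g j ≡ f i) → (∀ i → ∃ λ j → f j ≡ g i) →
                               ∀ i → f i ≡ g i
strictlyIncreasing-sameImage {f = f} {g} f↑ g↑ f⊆g g⊆f =
  All.wfRec <-wellFounded-Fin _ (λ i → f i ≡ g i) λ i agree →
    ℕP.≤-antisym (agreeBelow⇒≤ f↑ g↑ g⊆f i (λ j j<i → agree j<i))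
                 (agreeBelow⇒≤ g↑ f↑ f⊆g i (λ j j<i → sym (agree j<i)))

strictlyIncreasing-updateAt : ∀ {n} {s : Fin n → ℕ} → StrictlyIncreasing s → ∀ j₀ {p} →
                              (∀ j → j ≢ j₀ → s j < s j₀ → s j < p) →
                              (∀ j → j ≢ j₀ → s j₀ < s j → p < s j) →
                              StrictlyIncreasing (updateAt s j₀ (const p))
strictlyIncreasing-updateAt {s = s} s↑ j₀ below above i j i<j
  with i Data.Fin.≟ j₀ | j Data.Fin.≟ j₀
... | yes refl | yes refl = ⊥-elim (ℕP.<-irrefl refl i<j)
... | yes refl | no j≢j₀ =
  subst₂ _<_ (sym (updateAt-updates j₀ s)) (sym (updateAt-minimal j j₀ s j≢j₀)) (above j j≢j₀ (s↑ i j i<j))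
... | no i≢j₀ | yes refl =
  subst₂ _<_ (sym (updateAt-minimal i j₀ s i≢j₀)) (sym (updateAt-updates j₀ s)) (below i i≢j₀ (s↑ i j i<j))
... | no i≢j₀ | no j≢j₀ =
  subst₂ _<_ (sym (updateAt-minimal i j₀ s i≢j₀)) (sym (updateAt-minimal j j₀ s j≢j₀)) (s↑ i j i<j)

Grid : Set
Grid = ℕ → ℕ → ℤ

submatrix : ∀ {n} → Grid → (Fin n → ℕ) → (Fin n → ℕ) → Matrix n
submatrix A r s i j = A (r i) (s j)

δ : ℕ → ℕ → ℕ
δ x y = if x ≡ᵇ y then 1 else 0

δ-refl : ∀ x → δ x x ≡ 1
δ-refl zero    = refl
δ-refl (suc x) = δ-refl x

δ-≢ : ∀ {x y} → x ≢ y → δ x y ≡ 0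
δ-≢ {x} {y} x≢y with x ≡ᵇ y in eq
... | true  = ⊥-elim (x≢y (ℕP.≡ᵇ⇒≡ x y (subst T (sym eq) _)))
... | false = refl

identityGrid : Grid
identityGrid x y = + δ x y

addColumn : ℕ → ℕ → ℤ → Grid → Grid
addColumn q p l A x y with y ℕ.≟ q
... | yes _ = A x y + l * A x p
... | no  _ = A x y

addColumn-at : ∀ q p l A x → addColumn q p l A x q ≡ A x q + l * A x p
addColumn-at q p l A x with q ℕ.≟ q
... | yes _   = refl
... | no  q≢q = ⊥-elim (q≢q refl)

addColumn-off : ∀ q p l A x y → y ≢ q → addColumn q p l A x y ≡ A x y
addColumn-off q p l A x y y≢q with y ℕ.≟ q
... | yes y≡q = ⊥-elim (y≢q y≡q)
... | no  _   = refl

Adjacent : ℕ → ℕ → Set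
Adjacent q p = p ≡ suc q ⊎ q ≡ suc p

adjacent-sym : ∀ {q p} → Adjacent q p → Adjacent p q
adjacent-sym (inj₁ p≡1+q) = inj₂ p≡1+q
adjacent-sym (inj₂ q≡1+p) = inj₁ q≡1+p

adjacent-above : ∀ {q p x} → Adjacent q p → q < x → x ≢ p → p < x
adjacent-above (inj₁ refl) q<x x≢p = ℕP.≤∧≢⇒< q<x (λ e → x≢p (sym e))
adjacent-above (inj₂ refl) q<x _   = ℕP.<-trans (ℕP.n<1+n _) q<x

adjacent-below : ∀ {q p x} → Adjacent q p → x < q → x ≢ p → x < p
adjacent-below (inj₁ refl) x<q _   = ℕP.<-trans x<q (ℕP.n<1+n _)
adjacent-below (inj₂ refl) x<q x≢p = ℕP.≤∧≢⇒< (ℕP.≤-pred x<q) x≢p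

adjacent-≢ : ∀ {q p} → Adjacent q p → q ≢ p
adjacent-≢ (inj₁ refl) q≡1+q = ℕP.1+n≢n (sym q≡1+q)
adjacent-≢ (inj₂ refl) 1+p≡p = ℕP.1+n≢n 1+p≡p

module _ {n} (A : Grid) (r s : Fin n → ℕ) (q p : ℕ) (l : ℤ) where

  det-addColumn-unused : (∀ j → s j ≢ q) →
                         det n (submatrix (addColumn q p l A) r s) ≡ det n (submatrix A r s)
  det-addColumn-unused q∉s = det-cong n (λ i j → addColumn-off q p l A (r i) (s j) (q∉s j))

  det-addColumn-used : ∀ j₀ → s j₀ ≡ q → (∀ j → j ≢ j₀ → s j ≢ q) →
                       det n (submatrix (addColumn q p l A) r s)
                         ≡ det n (submatrix A r s) + l * det n (submatrix A r (updateAt s j₀ (const p)))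
  det-addColumn-used j₀ sj₀≡q q∉s = det-linear-column n j₀ l _ _ _ atj₀ off off′
    where
    atj₀ : ∀ x → addColumn q p l A (r x) (s j₀) ≡ A (r x) (s j₀) + l * A (r x) (updateAt s j₀ (const p) j₀)
    atj₀ x rewrite sj₀≡q | updateAt-updates j₀ {const p} s = addColumn-at q p l A (r x)
    off : ∀ x y → y ≢ j₀ → addColumn q p l A (r x) (s y) ≡ A (r x) (s y)
    off x y y≢j₀ = addColumn-off q p l A (r x) (s y) (q∉s y y≢j₀)
    off′ : ∀ x y → y ≢ j₀ → addColumn q p l A (r x) (s y) ≡ A (r x) (updateAt s j₀ (const p) y)
    off′ x y y≢j₀ rewrite updateAt-minimal y j₀ {const p} s y≢j₀ = off x y y≢j₀

  -- The replaced column duplicates its neighbour, so the extra determinant vanishes.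
  det-addColumn-adjacent : StrictlyIncreasing s → ∀ j₀ j₁ → s j₀ ≡ q → s j₁ ≡ p → Adjacent q p →
                           det n (submatrix (addColumn q p l A) r s) ≡ det n (submatrix A r s)
  det-addColumn-adjacent s↑ j₀ j₁ sj₀≡q sj₁≡p q~p =
    begin
      det n (submatrix (addColumn q p l A) r s)                  ≡⟨ det-addColumn-used j₀ sj₀≡q q∉s ⟩
      det n (submatrix A r s) + l * det n (submatrix A r s′)     ≡⟨ cong (λ d → det n (submatrix A r s) + l * d) (vanishes q~p) ⟩
      det n (submatrix A r s) + l * + 0                          ≡⟨ cong (λ z → det n (submatrix A r s) + z) (ℤP.*-zeroʳ l) ⟩
      det n (submatrix A r s) + + 0                              ≡⟨ ℤP.+-identityʳ _ ⟩
      det n (submatrix A r s)                                    ∎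
    where
    open ≡-Reasoning
    s′ = updateAt s j₀ (const p)
    q∉s : ∀ j → j ≢ j₀ → s j ≢ q
    q∉s j j≢j₀ sj≡q = j≢j₀ (strictlyIncreasing-injective s↑ j j₀ (trans sj≡q (sym sj₀≡q)))
    j₁≢j₀ : j₁ ≢ j₀
    j₁≢j₀ refl = adjacent-≢ q~p (trans (sym sj₀≡q) sj₁≡p)
    s′≡p : ∀ a → a ≡ j₀ ⊎ a ≡ j₁ → s′ a ≡ p
    s′≡p a (inj₁ refl) = updateAt-updates j₀ s
    s′≡p a (inj₂ refl) = trans (updateAt-minimal a j₀ s j₁≢j₀) sj₁≡p
    vanishes : Adjacent q p → det n (submatrix A r s′) ≡ + 0
    vanishes (inj₁ p≡1+q) = det-columnsEqualAt n _ (toℕ j₀) (subst (_< n) j₁≡1+j₀ (toℕ<n j₁))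
      (λ x a b a≡j₀ b≡1+j₀ → cong (A (r x)) (trans (s′≡p a (inj₁ (toℕ-injective a≡j₀)))
                                             (sym (s′≡p b (inj₂ (toℕ-injective (trans b≡1+j₀ (sym j₁≡1+j₀))))))))
      where j₁≡1+j₀ = strictlyIncreasing-consecutive s↑ j₀ j₁ (trans (cong suc sj₀≡q) (trans (sym p≡1+q) (sym sj₁≡p)))
    vanishes (inj₂ q≡1+p) = det-columnsEqualAt n _ (toℕ j₁) (subst (_< n) j₀≡1+j₁ (toℕ<n j₀))
      (λ x a b a≡j₁ b≡1+j₁ → cong (A (r x)) (trans (s′≡p a (inj₂ (toℕ-injective a≡j₁)))
                                             (sym (s′≡p b (inj₁ (toℕ-injective (trans b≡1+j₁ (sym j₀≡1+j₁))))))))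
      where j₀≡1+j₁ = strictlyIncreasing-consecutive s↑ j₁ j₀ (trans (cong suc sj₁≡p) (trans (sym q≡1+p) (sym sj₀≡q)))

updateAt-const : ∀ {n} (s : Fin n → ℕ) j₀ p i →
                 (i ≡ j₀ × updateAt s j₀ (const p) i ≡ p) ⊎ (i ≢ j₀ × updateAt s j₀ (const p) i ≡ s i)
updateAt-const s j₀ p i with i Data.Fin.≟ j₀
... | yes refl  = inj₁ (refl , updateAt-updates j₀ s)
... | no  i≢j₀ = inj₂ (i≢j₀ , updateAt-minimal i j₀ s i≢j₀)

InRange : ℕ → ℕ → Set
InRange M x = 1 ≤ x × x ≤ M

record Complementary (k m : ℕ) (s : Fin k → ℕ) (s̄ : Fin m → ℕ) : Set where
  field
    increasing  : StrictlyIncreasing s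
    increasinḡ  : StrictlyIncreasing s̄
    inRange     : ∀ i → InRange (k ℕ.+ m) (s i)
    complement  : ∀ x → ∃ (λ j → s̄ j ≡ x) ⇔ (InRange (k ℕ.+ m) x × ¬ ∃ (λ i → s i ≡ x))

  inRangē : ∀ j → InRange (k ℕ.+ m) (s̄ j)
  inRangē j = proj₁ (Equivalence.to (complement (s̄ j)) (j , refl))

  disjoint : ∀ j i → s̄ j ≢ s i
  disjoint j i s̄j≡si = proj₂ (Equivalence.to (complement (s̄ j)) (j , refl)) (i , sym s̄j≡si)

  complement-covers : ∀ x → InRange (k ℕ.+ m) x → ¬ ∃ (λ i → s i ≡ x) → ∃ λ j → s̄ j ≡ x
  complement-covers x x∈ x∉s = Equivalence.from (complement x) (x∈ , x∉s)

complementary-swap : ∀ {k m s s̄} → Complementary k m s s̄ → ∀ j₀ i₀ {q p} →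
                     s j₀ ≡ q → s̄ i₀ ≡ p → Adjacent q p →
                     Complementary k m (updateAt s j₀ (const p)) (updateAt s̄ i₀ (const q))
complementary-swap {k} {m} {s} {s̄} c j₀ i₀ {q} {p} sj₀≡q s̄i₀≡p q~p = record
  { increasing = strictlyIncreasing-updateAt increasing j₀
      (λ j _ sj<sj₀ → adjacent-below q~p (subst (s j <_) sj₀≡q sj<sj₀) (p∉s j))
      (λ j _ sj₀<sj → adjacent-above q~p (subst (_< s j) sj₀≡q sj₀<sj) (p∉s j))
  ; increasinḡ = strictlyIncreasing-updateAt increasinḡ i₀
      (λ i _ s̄i<s̄i₀ → adjacent-below (adjacent-sym q~p) (subst (s̄ i <_) s̄i₀≡p s̄i<s̄i₀) (q∉s̄ i))
      (λ i _ s̄i₀<s̄i → adjacent-above (adjacent-sym q~p) (subst (_< s̄ i) s̄i₀≡p s̄i₀<s̄i) (q∉s̄ i))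
  ; inRange = inRange′
  ; complement = λ x → mk⇔ (to x) (from x)
  }
  where
  open Complementary c
  s′ = updateAt s j₀ (const p)
  s̄′ = updateAt s̄ i₀ (const q)
  p∉s : ∀ j → s j ≢ p
  p∉s j sj≡p = disjoint i₀ j (trans s̄i₀≡p (sym sj≡p))
  q∉s̄ : ∀ i → s̄ i ≢ q
  q∉s̄ i s̄i≡q = disjoint i j₀ (trans s̄i≡q (sym sj₀≡q))
  inRange′ : ∀ j → InRange (k ℕ.+ m) (s′ j)
  inRange′ j with updateAt-const s j₀ p j
  ... | inj₁ (_ , s′j≡p) = subst (InRange (k ℕ.+ m)) (trans s̄i₀≡p (sym s′j≡p)) (inRangē i₀)
  ... | inj₂ (_ , s′j≡sj) = subst (InRange (k ℕ.+ m)) (sym s′j≡sj) (inRange j)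
  s′≢ : ∀ {x} → (∀ j → j ≢ j₀ → s j ≢ x) → p ≢ x → ¬ ∃ (λ j → s′ j ≡ x)
  s′≢ s≢x p≢x (j , s′j≡x) with updateAt-const s j₀ p j
  ... | inj₁ (_ , s′j≡p)     = p≢x (trans (sym s′j≡p) s′j≡x)
  ... | inj₂ (j≢j₀ , s′j≡sj) = s≢x j j≢j₀ (trans (sym s′j≡sj) s′j≡x)
  to : ∀ x → ∃ (λ i → s̄′ i ≡ x) → InRange (k ℕ.+ m) x × ¬ ∃ (λ j → s′ j ≡ x)
  to x (i , s̄′i≡x) with updateAt-const s̄ i₀ q i
  ... | inj₁ (_ , s̄′i≡q) rewrite sym (trans (sym s̄′i≡q) s̄′i≡x) =
    subst (InRange (k ℕ.+ m)) sj₀≡q (inRange j₀) ,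
    s′≢ (λ j j≢j₀ sj≡q → j≢j₀ (strictlyIncreasing-injective increasing j j₀ (trans sj≡q (sym sj₀≡q))))
        (λ p≡q → q∉s̄ i₀ (trans s̄i₀≡p p≡q))
  ... | inj₂ (i≢i₀ , s̄′i≡s̄i) rewrite sym (trans (sym s̄′i≡s̄i) s̄′i≡x) =
    inRangē i ,
    s′≢ (λ j _ sj≡s̄i → disjoint i j (sym sj≡s̄i))
        (λ p≡s̄i → i≢i₀ (strictlyIncreasing-injective increasinḡ i i₀ (trans (sym p≡s̄i) (sym s̄i₀≡p))))
  from : ∀ x → InRange (k ℕ.+ m) x × ¬ ∃ (λ j → s′ j ≡ x) → ∃ (λ i → s̄′ i ≡ x)
  from x (x∈ , x∉s′) with x ℕ.≟ q
  ... | yes refl = i₀ , updateAt-updates i₀ s̄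
  ... | no  x≢q  = i , trans (updateAt-minimal i i₀ s̄ i≢i₀) s̄i≡x
    where
    x∉s : ¬ ∃ (λ j → s j ≡ x)
    x∉s (j , sj≡x) with updateAt-const s j₀ p j
    ... | inj₁ (refl , _)     = x≢q (trans (sym sj≡x) sj₀≡q)
    ... | inj₂ (_ , s′j≡sj) = x∉s′ (j , trans s′j≡sj sj≡x)
    i = proj₁ (complement-covers x x∈ x∉s)
    s̄i≡x = proj₂ (complement-covers x x∈ x∉s)
    i≢i₀ : i ≢ i₀
    i≢i₀ i≡i₀ = x∉s′ (j₀ , trans (updateAt-updates j₀ s) (trans (sym s̄i₀≡p) (trans (cong s̄ (sym i≡i₀)) s̄i≡x)))

Σℕ-cong : ∀ n {f g : Fin n → ℕ} → (∀ i → f i ≡ g i) → Σℕ n f ≡ Σℕ n g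
Σℕ-cong zero    f≗g = refl
Σℕ-cong (suc n) f≗g = cong₂ ℕ._+_ (f≗g zero) (Σℕ-cong n (λ i → f≗g (suc i)))

Σℕ-exchange : ∀ n (f f′ : Fin n → ℕ) i₀ → (∀ i → i ≢ i₀ → f′ i ≡ f i) →
              Σℕ n f′ ℕ.+ f i₀ ≡ Σℕ n f ℕ.+ f′ i₀
Σℕ-exchange (suc n) f f′ zero f′≗f
  rewrite Σℕ-cong n {λ i → f′ (suc i)} {λ i → f (suc i)} (λ i → f′≗f (suc i) (λ ())) =
  swap (f′ zero) (Σℕ n (λ i → f (suc i))) (f zero)
  where swap : ∀ a s b → a ℕ.+ s ℕ.+ b ≡ b ℕ.+ s ℕ.+ a
        swap = ℕSolver.solve-∀
Σℕ-exchange (suc n) f f′ (suc i₀) f′≗f rewrite f′≗f zero (λ ()) =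
  trans (ℕP.+-assoc (f zero) _ (f (suc i₀)))
        (trans (cong (f zero ℕ.+_) (Σℕ-exchange n (λ i → f (suc i)) (λ i → f′ (suc i)) i₀
                                     (λ i i≢i₀ → f′≗f (suc i) (λ e → i≢i₀ (suc-injective e)))))
               (sym (ℕP.+-assoc (f zero) _ (f′ (suc i₀)))))

sign-+ : ∀ a b → sign (a ℕ.+ b) ≡ sign a * sign b
sign-+ = ℤP.^-distribˡ-+-* (- + 1)

sign-double : ∀ a → sign (a ℕ.+ a) ≡ + 1
sign-double zero    = refl
sign-double (suc a) rewrite ℕP.+-suc a a = trans (square (sign (a ℕ.+ a))) (sign-double a)
  where square : ∀ x → - + 1 * (- + 1 * x) ≡ x
        square = solve-∀

sign-Σℕ-double : ∀ n (f : Fin n → ℕ) → sign (Σℕ n (λ i → f i ℕ.+ f i)) ≡ + 1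
sign-Σℕ-double zero    f = refl
sign-Σℕ-double (suc n) f rewrite sign-+ (f zero ℕ.+ f zero) (Σℕ n (λ i → f (suc i) ℕ.+ f (suc i)))
                               | sign-double (f zero) | sign-Σℕ-double n (λ i → f (suc i)) = refl

sign-adjacent : ∀ X Y {q p} → X ℕ.+ p ≡ Y ℕ.+ q → Adjacent q p → sign X ≡ - sign Y
sign-adjacent X Y {q} (X+1+q≡Y+q) (inj₁ refl)
  rewrite sym (ℕP.+-cancelʳ-≡ q (suc X) Y (trans (sym (ℕP.+-suc X q)) X+1+q≡Y+q)) = flip (sign X)
  where flip : ∀ a → a ≡ - (- + 1 * a)
        flip = solve-∀
sign-adjacent X Y {_} {p} X+p≡Y+1+p (inj₂ refl)
  rewrite ℕP.+-cancelʳ-≡ p X (suc Y) (trans X+p≡Y+1+p (ℕP.+-suc Y p)) = flip (sign Y)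
  where flip : ∀ a → - + 1 * a ≡ - a
        flip = solve-∀

adjacent-+ˡ : ∀ a {q p} → Adjacent q p → Adjacent (a ℕ.+ q) (a ℕ.+ p)
adjacent-+ˡ a (inj₁ refl) = inj₁ (ℕP.+-suc a _)
adjacent-+ˡ a (inj₂ refl) = inj₂ (ℕP.+-suc a _)

ComplementaryMinors : ℕ → ℕ → Grid → Grid → Set
ComplementaryMinors k m A H = ∀ {r r̄ s s̄} → Complementary k m r r̄ → Complementary k m s s̄ →
  det k (submatrix A r s) ≡ sign (Σℕ m (λ i → r̄ i ℕ.+ s̄ i)) * det m (submatrix H r̄ s̄)

module _ {k m : ℕ} {A H : Grid} {q p : ℕ} (q~p : Adjacent q p) (minors : ComplementaryMinors k m A H)
         {r r̄ s s̄} (cr : Complementary k m r r̄) (cs : Complementary k m s s̄) where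

  private
    A′ H′ : Grid
    A′ = addColumn q p (+ 1) A
    H′ = addColumn p q (- + 1) H
    σ = sign (Σℕ m (λ i → r̄ i ℕ.+ s̄ i))

  open Complementary cs

  minors-addColumn-target-unused : InRange (k ℕ.+ m) q → (∀ j → s j ≢ q) →
                                   det k (submatrix A′ r s) ≡ σ * det m (submatrix H′ r̄ s̄)
  minors-addColumn-target-unused q∈ q∉s =
    trans (det-addColumn-unused A r s q p (+ 1) q∉s) (trans (minors cr cs) (cong (σ *_) (sym H-unchanged)))
    where
    q∈s̄ = complement-covers q q∈ (λ (j , sj≡q) → q∉s j sj≡q)
    H-unchanged : det m (submatrix H′ r̄ s̄) ≡ det m (submatrix H r̄ s̄)
    H-unchanged with any? (λ i → s̄ i ℕ.≟ p)
    ... | no  p∉s̄          = det-addColumn-unused H r̄ s̄ p q (- + 1) (λ i s̄i≡p → p∉s̄ (i , s̄i≡p))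
    ... | yes (i₀ , s̄i₀≡p) = det-addColumn-adjacent H r̄ s̄ p q (- + 1) increasinḡ i₀ (proj₁ q∈s̄) s̄i₀≡p (proj₂ q∈s̄)
                                 (adjacent-sym q~p)

  minors-addColumn-both-used : ∀ j₀ j₁ → s j₀ ≡ q → s j₁ ≡ p →
                               det k (submatrix A′ r s) ≡ σ * det m (submatrix H′ r̄ s̄)
  minors-addColumn-both-used j₀ j₁ sj₀≡q sj₁≡p =
    trans (det-addColumn-adjacent A r s q p (+ 1) increasing j₀ j₁ sj₀≡q sj₁≡p q~p)
          (trans (minors cr cs)
                 (cong (σ *_) (sym (det-addColumn-unused H r̄ s̄ p q (- + 1)
                                      (λ i s̄i≡p → disjoint i j₁ (trans s̄i≡p (sym sj₁≡p)))))))

  -- Both sides split by linearity; the second terms are complementary minors for the swapped index sets.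
  minors-addColumn-source-unused : ∀ j₀ → s j₀ ≡ q → InRange (k ℕ.+ m) p → (∀ j → s j ≢ p) →
                                   det k (submatrix A′ r s) ≡ σ * det m (submatrix H′ r̄ s̄)
  minors-addColumn-source-unused j₀ sj₀≡q p∈ p∉s =
    begin
      det k (submatrix A′ r s)                          ≡⟨ det-addColumn-used A r s q p (+ 1) j₀ sj₀≡q q∉s-elsewhere ⟩
      det k (submatrix A r s) + + 1 * det k (submatrix A r s′)
                                                        ≡⟨ cong₂ (λ u v → u + + 1 * v) (minors cr cs) (minors cr cs′) ⟩
      σ * E + + 1 * (σ′ * E′)                           ≡⟨ cong (λ z → σ * E + + 1 * (z * E′)) σ′≡-σ ⟩
      σ * E + + 1 * (- σ * E′)                          ≡⟨ regroup σ E E′ ⟩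
      σ * (E + - + 1 * E′)                              ≡⟨ cong (σ *_) (det-addColumn-used H r̄ s̄ p q (- + 1) i₀ s̄i₀≡p p∉s̄-elsewhere) ⟨
      σ * det m (submatrix H′ r̄ s̄)                      ∎
    where
    open ≡-Reasoning
    i₀ = proj₁ (complement-covers p p∈ (λ (j , sj≡p) → p∉s j sj≡p))
    s̄i₀≡p = proj₂ (complement-covers p p∈ (λ (j , sj≡p) → p∉s j sj≡p))
    s′ = updateAt s j₀ (const p)
    s̄′ = updateAt s̄ i₀ (const q)
    cs′ = complementary-swap cs j₀ i₀ sj₀≡q s̄i₀≡p q~p
    σ′ = sign (Σℕ m (λ i → r̄ i ℕ.+ s̄′ i))
    E = det m (submatrix H r̄ s̄)
    E′ = det m (submatrix H r̄ s̄′)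
    q∉s-elsewhere : ∀ j → j ≢ j₀ → s j ≢ q
    q∉s-elsewhere j j≢j₀ sj≡q = j≢j₀ (strictlyIncreasing-injective increasing j j₀ (trans sj≡q (sym sj₀≡q)))
    p∉s̄-elsewhere : ∀ i → i ≢ i₀ → s̄ i ≢ p
    p∉s̄-elsewhere i i≢i₀ s̄i≡p = i≢i₀ (strictlyIncreasing-injective increasinḡ i i₀ (trans s̄i≡p (sym s̄i₀≡p)))
    σ′≡-σ : σ′ ≡ - σ
    σ′≡-σ = sign-adjacent (Σℕ m (λ i → r̄ i ℕ.+ s̄′ i)) (Σℕ m (λ i → r̄ i ℕ.+ s̄ i))
      (Σℕ-exchange m (λ i → r̄ i ℕ.+ s̄ i) (λ i → r̄ i ℕ.+ s̄′ i) i₀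
         (λ i i≢i₀ → cong (r̄ i ℕ.+_) (updateAt-minimal i i₀ s̄ i≢i₀)))
      (subst₂ Adjacent (cong (r̄ i₀ ℕ.+_) (sym (updateAt-updates i₀ s̄))) (cong (r̄ i₀ ℕ.+_) (sym s̄i₀≡p))
         (adjacent-+ˡ (r̄ i₀) q~p))
    regroup : ∀ σ E E′ → σ * E + + 1 * (- σ * E′) ≡ σ * (E + - + 1 * E′)
    regroup = solve-∀

complementaryMinors-addColumn : ∀ {k m A H q p} → InRange (k ℕ.+ m) q → InRange (k ℕ.+ m) p → Adjacent q p →
                                ComplementaryMinors k m A H →
                                ComplementaryMinors k m (addColumn q p (+ 1) A) (addColumn p q (- + 1) H)
complementaryMinors-addColumn {q = q} {p} q∈ p∈ q~p minors {s = s} cr cs with any? (λ j → s j ℕ.≟ q) | any? (λ j → s j ℕ.≟ p)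
... | no q∉s           | _                = minors-addColumn-target-unused q~p minors cr cs q∈ (λ j sj≡q → q∉s (j , sj≡q))
... | yes (j₀ , sj₀≡q) | yes (j₁ , sj₁≡p) = minors-addColumn-both-used q~p minors cr cs j₀ j₁ sj₀≡q sj₁≡p
... | yes (j₀ , sj₀≡q) | no p∉s           = minors-addColumn-source-unused q~p minors cr cs j₀ sj₀≡q p∈ (λ j sj≡p → p∉s (j , sj≡p))

complement-unique : ∀ {k m r r̄ s s̄} → Complementary k m r r̄ → Complementary k m s s̄ →
                    (∀ i → r i ≡ s i) → ∀ i → r̄ i ≡ s̄ i
complement-unique cr cs r≗s = strictlyIncreasing-sameImage (Complementary.increasinḡ cr) (Complementary.increasinḡ cs)
  (λ a → Complementary.complement-covers cs _ (Complementary.inRangē cr a)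
           (λ (j , sj≡r̄a) → Complementary.disjoint cr a j (trans (sym sj≡r̄a) (sym (r≗s j)))))
  (λ b → Complementary.complement-covers cr _ (Complementary.inRangē cs b)
           (λ (i , ri≡s̄b) → Complementary.disjoint cs b i (trans (sym ri≡s̄b) (r≗s i))))

det-submatrix-identityGrid : ∀ {n} {r s : Fin n → ℕ} → StrictlyIncreasing r → (∀ i → r i ≡ s i) →
                             det n (submatrix identityGrid r s) ≡ + 1
det-submatrix-identityGrid {n} {r} {s} r↑ r≗s = det-identity n _
  (λ i → cong +_ (trans (cong (δ (r i)) (sym (r≗s i))) (δ-refl (r i))))
  (λ i j i≢j → cong +_ (δ-≢ (λ ri≡sj → i≢j (strictlyIncreasing-injective r↑ i j (trans ri≡sj (sym (r≗s j)))))))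

complementaryMinors-identityGrid : ∀ {k m} → ComplementaryMinors k m identityGrid identityGrid
complementaryMinors-identityGrid {k} {m} {r} {r̄} {s} {s̄} cr cs
  with any? (λ i → ¬? (any? (λ j → s j ℕ.≟ r i)))
... | yes (i , ri∉s) =
  trans (det-zero-row k _ i (λ j → cong +_ (δ-≢ (λ ri≡sj → ri∉s (j , sym ri≡sj)))))
        (sym (trans (cong (σ *_) (det-zero-column m _ c (λ a → cong +_ (δ-≢ (λ r̄a≡s̄c →
                       Complementary.disjoint cr a i (trans r̄a≡s̄c s̄c≡ri))))))
                    (ℤP.*-zeroʳ σ)))
  where
  σ = sign (Σℕ m (λ i → r̄ i ℕ.+ s̄ i))
  c = proj₁ (Complementary.complement-covers cs (r i) (Complementary.inRange cr i) ri∉s)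
  s̄c≡ri = proj₂ (Complementary.complement-covers cs (r i) (Complementary.inRange cr i) ri∉s)
... | no r⊈s with any? (λ j → ¬? (any? (λ i → r i ℕ.≟ s j)))
...   | yes (j , sj∉r) =
  trans (det-zero-column k _ j (λ i → cong +_ (δ-≢ (λ ri≡sj → sj∉r (i , ri≡sj)))))
        (sym (trans (cong (σ *_) (det-zero-row m _ c (λ b → cong +_ (δ-≢ (λ r̄c≡s̄b →
                       Complementary.disjoint cs b j (trans (sym r̄c≡s̄b) r̄c≡sj))))))
                    (ℤP.*-zeroʳ σ)))
  where
  σ = sign (Σℕ m (λ i → r̄ i ℕ.+ s̄ i))
  c = proj₁ (Complementary.complement-covers cr (s j) (Complementary.inRange cs j) sj∉r)
  r̄c≡sj = proj₂ (Complementary.complement-covers cr (s j) (Complementary.inRange cs j) sj∉r)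
...   | no s⊈r =
  trans (det-submatrix-identityGrid (Complementary.increasing cr) r≗s)
        (sym (cong₂ _*_ (trans (cong sign (Σℕ-cong m (λ i → cong (r̄ i ℕ.+_) (sym (r̄≗s̄ i))))) (sign-Σℕ-double m r̄))
                        (det-submatrix-identityGrid (Complementary.increasinḡ cr) r̄≗s̄)))
  where
  r⊆s : ∀ i → ∃ λ j → s j ≡ r i
  r⊆s i = decidable-stable (any? (λ j → s j ℕ.≟ r i)) (λ ri∉s → r⊈s (i , ri∉s))
  s⊆r : ∀ j → ∃ λ i → r i ≡ s j
  s⊆r j = decidable-stable (any? (λ i → r i ℕ.≟ s j)) (λ sj∉r → s⊈r (j , sj∉r))
  r≗s : ∀ i → r i ≡ s i
  r≗s = strictlyIncreasing-sameImage (Complementary.increasing cr) (Complementary.increasing cs) r⊆s s⊆r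
  r̄≗s̄ : ∀ i → r̄ i ≡ s̄ i
  r̄≗s̄ = complement-unique cr cs r≗s

ColumnOps : Set
ColumnOps = List (ℕ × ℕ)

applyOps : ColumnOps → Grid → Grid
applyOps []             A = A
applyOps ((q , p) ∷ os) A = applyOps os (addColumn q p (+ 1) A)

applyDualOps : ColumnOps → Grid → Grid
applyDualOps []             H = H
applyDualOps ((q , p) ∷ os) H = applyDualOps os (addColumn p q (- + 1) H)

applyOps-++ : ∀ os os′ A → applyOps (os ++ os′) A ≡ applyOps os′ (applyOps os A)
applyOps-++ []             os′ A = refl
applyOps-++ ((q , p) ∷ os) os′ A = applyOps-++ os os′ _

applyDualOps-++ : ∀ os os′ H → applyDualOps (os ++ os′) H ≡ applyDualOps os′ (applyDualOps os H)
applyDualOps-++ []             os′ H = refl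
applyDualOps-++ ((q , p) ∷ os) os′ H = applyDualOps-++ os os′ _

Admissible : ℕ → ColumnOps → Set
Admissible M []             = ⊤
Admissible M ((q , p) ∷ os) = InRange M q × InRange M p × Adjacent q p × Admissible M os

admissible-++ : ∀ M os os′ → Admissible M os → Admissible M os′ → Admissible M (os ++ os′)
admissible-++ M []             os′ _                 ok′ = ok′
admissible-++ M ((q , p) ∷ os) os′ (q∈ , p∈ , q~p , ok) ok′ = q∈ , p∈ , q~p , admissible-++ M os os′ ok ok′

complementaryMinors-applyOps : ∀ {k m} os {A H} → Admissible (k ℕ.+ m) os → ComplementaryMinors k m A H →
                               ComplementaryMinors k m (applyOps os A) (applyDualOps os H)
complementaryMinors-applyOps []             _                      minors = minors
complementaryMinors-applyOps ((q , p) ∷ os) (q∈ , p∈ , q~p , ok) minors =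
  complementaryMinors-applyOps os ok (complementaryMinors-addColumn q∈ p∈ q~p minors)

AgreeOn : ℕ → Grid → Grid → Set
AgreeOn M A B = ∀ x y → InRange M x → InRange M y → A x y ≡ B x y

complementaryMinors-agreeOn : ∀ {k m A A′ H H′} → AgreeOn (k ℕ.+ m) A A′ → AgreeOn (k ℕ.+ m) H H′ →
                              ComplementaryMinors k m A H → ComplementaryMinors k m A′ H′
complementaryMinors-agreeOn {k} {m} A≈A′ H≈H′ minors {r} {r̄} {s} {s̄} cr cs =
  trans (det-cong k (λ i j → sym (A≈A′ (r i) (s j) (Complementary.inRange cr i) (Complementary.inRange cs j))))
        (trans (minors cr cs)
               (cong (sign (Σℕ m (λ i → r̄ i ℕ.+ s̄ i)) *_)
                     (det-cong m (λ i j → H≈H′ (r̄ i) (s̄ j) (Complementary.inRangē cr i) (Complementary.inRangē cs j)))))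

risingOps : ℕ → ℕ → ColumnOps
risingOps zero    a = []
risingOps (suc t) a = (a , suc a) ∷ risingOps t (suc a)

fallingOps : ℕ → ℕ → ColumnOps
fallingOps zero    b = []
fallingOps (suc t) b = (suc (b ℕ.+ t) , b ℕ.+ t) ∷ fallingOps t b

admissible-rising : ∀ M t a → 1 ≤ a → a ℕ.+ t ≤ M → Admissible M (risingOps t a)
admissible-rising M zero    a _   _         = tt
admissible-rising M (suc t) a 1≤a a+1+t≤M =
  (1≤a , ℕP.≤-trans (ℕP.m≤m+n a (suc t)) a+1+t≤M) ,
  (s≤s z≤n , ℕP.≤-trans (s≤s (ℕP.m≤m+n a t)) 1+a+t≤M) ,
  inj₁ refl ,
  admissible-rising M t (suc a) (s≤s z≤n) 1+a+t≤M
  where 1+a+t≤M = subst (_≤ M) (ℕP.+-suc a t) a+1+t≤M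

admissible-falling : ∀ M t b → 1 ≤ b → b ℕ.+ t ≤ M → Admissible M (fallingOps t b)
admissible-falling M zero    b _   _         = tt
admissible-falling M (suc t) b 1≤b b+1+t≤M =
  (s≤s z≤n , subst (_≤ M) (ℕP.+-suc b t) b+1+t≤M) ,
  (ℕP.≤-trans 1≤b (ℕP.m≤m+n b t) , ℕP.≤-trans (ℕP.n≤1+n (b ℕ.+ t)) (subst (_≤ M) (ℕP.+-suc b t) b+1+t≤M)) ,
  inj₂ refl ,
  admissible-falling M t b 1≤b (ℕP.≤-trans (ℕP.+-monoʳ-≤ b (ℕP.n≤1+n t)) b+1+t≤M)

applyOps-rising-outside : ∀ t a X x y → y < a ⊎ a ℕ.+ t ≤ y → applyOps (risingOps t a) X x y ≡ X x y
applyOps-rising-outside zero    a X x y _ = refl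
applyOps-rising-outside (suc t) a X x y (inj₁ y<a) =
  trans (applyOps-rising-outside t (suc a) _ x y (inj₁ (ℕP.m<n⇒m<1+n y<a)))
        (addColumn-off a (suc a) (+ 1) X x y (λ y≡a → ℕP.<-irrefl y≡a y<a))
applyOps-rising-outside (suc t) a X x y (inj₂ a+1+t≤y) =
  trans (applyOps-rising-outside t (suc a) _ x y (inj₂ (subst (_≤ y) (ℕP.+-suc a t) a+1+t≤y)))
        (addColumn-off a (suc a) (+ 1) X x y (λ y≡a → ℕP.<-irrefl (sym y≡a) (ℕP.<-≤-trans (ℕP.m<m+n a (s≤s z≤n)) a+1+t≤y)))

applyOps-rising-inside : ∀ t a X x y → a ≤ y → y < a ℕ.+ t →
                         applyOps (risingOps t a) X x y ≡ X x y + X x (suc y)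
applyOps-rising-inside zero    a X x y a≤y y<a+0 = ⊥-elim (ℕP.<-irrefl refl (ℕP.≤-<-trans a≤y (subst (y <_) (ℕP.+-identityʳ a) y<a+0)))
applyOps-rising-inside (suc t) a X x y a≤y y<a+1+t with ℕP.m≤n⇒m<n∨m≡n a≤y
... | inj₂ refl =
  trans (applyOps-rising-outside t (suc y) _ x y (inj₁ (ℕP.n<1+n y)))
        (trans (addColumn-at y (suc y) (+ 1) X x) (cong (λ z → X x y + z) (ℤP.*-identityˡ _)))
... | inj₁ a<y =
  trans (applyOps-rising-inside t (suc a) _ x y a<y (subst (y <_) (ℕP.+-suc a t) y<a+1+t))
        (cong₂ _+_ (addColumn-off a (suc a) (+ 1) X x y (λ y≡a → ℕP.<-irrefl (sym y≡a) a<y))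
                   (addColumn-off a (suc a) (+ 1) X x (suc y) (λ 1+y≡a → ℕP.<-irrefl (sym 1+y≡a) (ℕP.m<n⇒m<1+n a<y))))

applyOps-falling-outside : ∀ t b X x y → y ≤ b ⊎ b ℕ.+ t < y → applyOps (fallingOps t b) X x y ≡ X x y
applyOps-falling-outside zero    b X x y _ = refl
applyOps-falling-outside (suc t) b X x y (inj₁ y≤b) =
  trans (applyOps-falling-outside t b _ x y (inj₁ y≤b))
        (addColumn-off _ _ (+ 1) X x y (λ y≡ → ℕP.<-irrefl y≡ (s≤s (ℕP.≤-trans y≤b (ℕP.m≤m+n b t)))))
applyOps-falling-outside (suc t) b X x y (inj₂ b+1+t<y) =
  trans (applyOps-falling-outside t b _ x y (inj₂ (ℕP.<-trans (ℕP.+-monoʳ-< b (ℕP.n<1+n t)) b+1+t<y)))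
        (addColumn-off _ _ (+ 1) X x y (λ y≡ → ℕP.<-irrefl (sym y≡) (subst (_< y) (ℕP.+-suc b t) b+1+t<y)))

applyOps-falling-inside : ∀ t b X x y → b ≤ y → y < b ℕ.+ t →
                          applyOps (fallingOps t b) X x (suc y) ≡ X x (suc y) + X x y
applyOps-falling-inside zero    b X x y b≤y y<b+0 = ⊥-elim (ℕP.<-irrefl refl (ℕP.≤-<-trans b≤y (subst (y <_) (ℕP.+-identityʳ b) y<b+0)))
applyOps-falling-inside (suc t) b X x y b≤y y<b+1+t with ℕP.m≤n⇒m<n∨m≡n (ℕP.≤-pred (subst (y <_) (ℕP.+-suc b t) y<b+1+t))
... | inj₂ refl =
  trans (applyOps-falling-outside t b _ x (suc (b ℕ.+ t)) (inj₂ (ℕP.n<1+n _)))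
        (trans (addColumn-at _ _ (+ 1) X x) (cong (λ z → X x (suc (b ℕ.+ t)) + z) (ℤP.*-identityˡ _)))
... | inj₁ y<b+t =
  trans (applyOps-falling-inside t b _ x y b≤y y<b+t)
        (cong₂ _+_ (addColumn-off _ _ (+ 1) X x (suc y) (λ 1+y≡ → ℕP.<-irrefl (ℕP.suc-injective 1+y≡) y<b+t))
                   (addColumn-off _ _ (+ 1) X x y (λ y≡ → ℕP.<-irrefl y≡ (ℕP.m<n⇒m<1+n y<b+t))))

applyDualOps-rising-below : ∀ t a X x y → y ≤ a → applyDualOps (risingOps t a) X x y ≡ X x y
applyDualOps-rising-below zero    a X x y _   = refl
applyDualOps-rising-below (suc t) a X x y y≤a =
  trans (applyDualOps-rising-below t (suc a) _ x y (ℕP.m≤n⇒m≤1+n y≤a))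
        (addColumn-off (suc a) a (- + 1) X x y (λ y≡1+a → ℕP.<-irrefl y≡1+a (s≤s y≤a)))

applyDualOps-rising : ∀ t a (Q P : Grid) x → Q x a ≡ P x a →
                      (∀ y → a ≤ y → y < a ℕ.+ t → Q x (suc y) ≡ P x (suc y) + P x y) →
                      ∀ y → a ≤ y → y ≤ a ℕ.+ t → applyDualOps (risingOps t a) Q x y ≡ P x y
applyDualOps-rising zero a Q P x Qa≡Pa _ y a≤y y≤a+0
  with refl ← ℕP.≤-antisym a≤y (subst (y ≤_) (ℕP.+-identityʳ a) y≤a+0) = Qa≡Pa
applyDualOps-rising (suc t) a Q P x Qa≡Pa step y a≤y y≤a+1+t with ℕP.m≤n⇒m<n∨m≡n a≤y
... | inj₂ refl =
  trans (applyDualOps-rising-below t (suc y) _ x y (ℕP.n≤1+n y))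
        (trans (addColumn-off (suc y) y (- + 1) Q x y (λ y≡1+y → ℕP.1+n≢n (sym y≡1+y))) Qa≡Pa)
... | inj₁ a<y = applyDualOps-rising t (suc a) Q′ P x Q′1+a≡P1+a step′ y a<y (subst (y ≤_) (ℕP.+-suc a t) y≤a+1+t)
  where
  Q′ = addColumn (suc a) a (- + 1) Q
  Q′1+a≡P1+a : Q′ x (suc a) ≡ P x (suc a)
  Q′1+a≡P1+a = trans (addColumn-at (suc a) a (- + 1) Q x)
    (trans (cong₂ (λ u v → u + - + 1 * v) (step a ℕP.≤-refl (ℕP.m<m+n a (s≤s z≤n))) Qa≡Pa) (cancel (P x (suc a)) (P x a)))
    where cancel : ∀ u v → u + v + - + 1 * v ≡ u
          cancel = solve-∀
  step′ : ∀ y → suc a ≤ y → y < suc a ℕ.+ t → Q′ x (suc y) ≡ P x (suc y) + P x y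
  step′ y a<y y<1+a+t =
    trans (addColumn-off (suc a) a (- + 1) Q x (suc y) (λ 1+y≡1+a → ℕP.<-irrefl (ℕP.suc-injective (sym 1+y≡1+a)) a<y))
          (step y (ℕP.<⇒≤ a<y) (subst (y <_) (sym (ℕP.+-suc a t)) y<1+a+t))

applyDualOps-falling-above : ∀ t b X x y → b ℕ.+ t ≤ y → applyDualOps (fallingOps t b) X x y ≡ X x y
applyDualOps-falling-above zero    b X x y _       = refl
applyDualOps-falling-above (suc t) b X x y b+1+t≤y =
  trans (applyDualOps-falling-above t b _ x y (ℕP.≤-trans (ℕP.+-monoʳ-≤ b (ℕP.n≤1+n t)) b+1+t≤y))
        (addColumn-off (b ℕ.+ t) _ (- + 1) X x y (λ y≡b+t → ℕP.<-irrefl (sym y≡b+t) (subst (_≤ y) (ℕP.+-suc b t) b+1+t≤y)))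

applyDualOps-falling : ∀ t b (Q P : Grid) x → Q x (b ℕ.+ t) ≡ P x (b ℕ.+ t) →
                       (∀ y → b ≤ y → y < b ℕ.+ t → Q x y ≡ P x y + P x (suc y)) →
                       ∀ y → b ≤ y → y ≤ b ℕ.+ t → applyDualOps (fallingOps t b) Q x y ≡ P x y
applyDualOps-falling zero b Q P x Qb≡Pb _ y b≤y y≤b+0
  with refl ← ℕP.≤-antisym y≤b+0 (subst (_≤ y) (sym (ℕP.+-identityʳ b)) b≤y) = Qb≡Pb
applyDualOps-falling (suc t) b Q P x Qtop≡Ptop step y b≤y y≤b+1+t with ℕP.m≤n⇒m<n∨m≡n y≤b+1+t
... | inj₂ refl =
  trans (applyDualOps-falling-above t b _ x (b ℕ.+ suc t) (ℕP.+-monoʳ-≤ b (ℕP.n≤1+n t)))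
        (trans (addColumn-off (b ℕ.+ t) _ (- + 1) Q x _
                  (λ e → ℕP.<-irrefl (sym e) (subst (b ℕ.+ t <_) (sym (ℕP.+-suc b t)) (ℕP.n<1+n _))))
               Qtop≡Ptop)
... | inj₁ y<b+1+t = applyDualOps-falling t b Q′ P x Q′top≡Ptop step′ y b≤y (ℕP.≤-pred (subst (y <_) (ℕP.+-suc b t) y<b+1+t))
  where
  Q′ = addColumn (b ℕ.+ t) (suc (b ℕ.+ t)) (- + 1) Q
  Q′top≡Ptop : Q′ x (b ℕ.+ t) ≡ P x (b ℕ.+ t)
  Q′top≡Ptop = trans (addColumn-at (b ℕ.+ t) _ (- + 1) Q x)
    (trans (cong₂ (λ u v → u + - + 1 * v)
                  (step (b ℕ.+ t) (ℕP.m≤m+n b t) (ℕP.+-monoʳ-< b (ℕP.n<1+n t)))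
                  (trans (cong (Q x) (sym (ℕP.+-suc b t))) (trans Qtop≡Ptop (cong (P x) (ℕP.+-suc b t)))))
           (cancel (P x (b ℕ.+ t)) (P x (suc (b ℕ.+ t)))))
    where cancel : ∀ u v → u + v + - + 1 * v ≡ u
          cancel = solve-∀
  step′ : ∀ y → b ≤ y → y < b ℕ.+ t → Q′ x y ≡ P x y + P x (suc y)
  step′ y b≤y y<b+t =
    trans (addColumn-off (b ℕ.+ t) _ (- + 1) Q x y (λ y≡b+t → ℕP.<-irrefl y≡b+t y<b+t))
          (step y b≤y (ℕP.<-trans y<b+t (ℕP.+-monoʳ-< b (ℕP.n<1+n t))))

countTrue-++ : ∀ {A : Set} (p : A → Bool) xs ys → countTrue p (xs ++ ys) ≡ countTrue p xs ℕ.+ countTrue p ys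
countTrue-++ p []       ys = refl
countTrue-++ p (x ∷ xs) ys rewrite countTrue-++ p xs ys = sym (ℕP.+-assoc (if p x then 1 else 0) _ _)

countTrue-map : ∀ {A : Set} (p : A → Bool) (f : A → A) xs → countTrue p (map f xs) ≡ countTrue (λ x → p (f x)) xs
countTrue-map p f []       = refl
countTrue-map p f (x ∷ xs) rewrite countTrue-map p f xs = refl

countTrue-cong : ∀ {A : Set} {p q : A → Bool} xs → (∀ x → p x ≡ q x) → countTrue p xs ≡ countTrue q xs
countTrue-cong []       p≗q = refl
countTrue-cong (x ∷ xs) p≗q rewrite p≗q x | countTrue-cong xs p≗q = refl

countTrue-false : ∀ {A : Set} {p : A → Bool} xs → (∀ x → p x ≡ false) → countTrue p xs ≡ 0
countTrue-false []       p≗false = refl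
countTrue-false (x ∷ xs) p≗false rewrite p≗false x | countTrue-false xs p≗false = refl

≤ᵇ-true : ∀ {a b} → a ≤ b → (a ≤ᵇ b) ≡ true
≤ᵇ-true a≤b = Equivalence.to T-≡ (ℕP.≤⇒≤ᵇ a≤b)

≤ᵇ-false : ∀ {a b} → b < a → (a ≤ᵇ b) ≡ false
≤ᵇ-false {a} {b} b<a with a ≤ᵇ b in eq
... | true  = ⊥-elim (ℕP.<-irrefl refl (ℕP.<-≤-trans b<a (ℕP.≤ᵇ⇒≤ a b (Equivalence.from T-≡ eq))))
... | false = refl

firstStep : (ℕ → ℕ → ℕ) → ℕ → ℕ → ℕ
firstStep g zero    b = g 1 b
firstStep g (suc a) b = g (suc (suc a)) b ℕ.+ g a b

lastStep : (ℕ → ℕ → ℕ) → ℕ → ℕ → ℕ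
lastStep g a zero    = g a 1
lastStep g a (suc b) = g a (suc (suc b)) ℕ.+ g a b

firstStep-lastStep-comm : ∀ g a b → firstStep (lastStep g) a b ≡ lastStep (firstStep g) a b
firstStep-lastStep-comm g zero    zero    = refl
firstStep-lastStep-comm g zero    (suc b) = refl
firstStep-lastStep-comm g (suc a) zero    = refl
firstStep-lastStep-comm g (suc a) (suc b) =
  interchange (g (suc (suc a)) (suc (suc b))) (g (suc (suc a)) b) (g a (suc (suc b))) (g a b)
  where interchange : ∀ w x y z → (w ℕ.+ x) ℕ.+ (y ℕ.+ z) ≡ (w ℕ.+ y) ℕ.+ (x ℕ.+ z)
        interchange = ℕSolver.solve-∀

firstStep-δ≡lastStep-δ : ∀ a b → firstStep δ a b ≡ lastStep δ a b
firstStep-δ≡lastStep-δ zero    zero    = refl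
firstStep-δ≡lastStep-δ zero    (suc b) = refl
firstStep-δ≡lastStep-δ (suc a) zero    = refl
firstStep-δ≡lastStep-δ (suc a) (suc b) = ℕP.+-comm (δ (suc a) b) (δ a (suc b))

module _ (K : ℕ) where

  staysAndEnds-above : ∀ h ps b → h ≤ K → K < b → staysAndEnds K h ps b ≡ false
  staysAndEnds-above h []          b h≤K K<b with h ≡ᵇ b in eq
  ... | true  = ⊥-elim (ℕP.<-irrefl (ℕP.≡ᵇ⇒≡ h b (Equivalence.from T-≡ eq)) (ℕP.≤-<-trans h≤K K<b))
  ... | false = refl
  staysAndEnds-above h (up ∷ ps)   b h≤K K<b with suc h ≤ᵇ K in eq
  ... | true  = staysAndEnds-above (suc h) ps b (ℕP.≤ᵇ⇒≤ (suc h) K (Equivalence.from T-≡ eq)) K<b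
  ... | false = refl
  staysAndEnds-above zero    (down ∷ ps) b h≤K K<b = refl
  staysAndEnds-above (suc h) (down ∷ ps) b h≤K K<b = staysAndEnds-above h ps b (ℕP.<⇒≤ h≤K) K<b

  C-target-above : ∀ N a b → K < b → C K N a b ≡ 0
  C-target-above N a b K<b = countTrue-false (allPaths N) never
    where never : ∀ ps → isPath K a b ps ≡ false
          never ps with a ≤ᵇ K in eq
          ... | true  = staysAndEnds-above a ps b (ℕP.≤ᵇ⇒≤ a K (Equivalence.from T-≡ eq)) K<b
          ... | false = refl

  C-source-above : ∀ N a b → K < a → C K N a b ≡ 0
  C-source-above N a b K<a = countTrue-false (allPaths N) (λ ps → cong (_∧ staysAndEnds K a ps b) (≤ᵇ-false K<a))

  C-zero-length : ∀ x y → x ≤ K ⊎ y ≤ K → C K 0 x y ≡ δ x y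
  C-zero-length x y bounded with x ≤ᵇ K in eq
  ... | true  = ℕP.+-identityʳ _
  ... | false with x ≡ᵇ y in eq′
  ...   | false = refl
  ...   | true  with ℕP.≡ᵇ⇒≡ x y (Equivalence.from T-≡ eq′) | bounded
  ...     | refl | inj₁ x≤K = ⊥-elim (subst T eq (ℕP.≤⇒≤ᵇ x≤K))
  ...     | refl | inj₂ x≤K = ⊥-elim (subst T eq (ℕP.≤⇒≤ᵇ x≤K))

  C-suc-firstStep : ∀ N a b → a ≤ K → C K (suc N) a b ≡ firstStep (C K N) a b
  C-suc-firstStep N a b a≤K =
    trans (countTrue-++ (isPath K a b) (map (up ∷_) (allPaths N)) (map (down ∷_) (allPaths N)))
          (trans (cong₂ ℕ._+_ (countTrue-map (isPath K a b) (up ∷_) (allPaths N))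
                              (countTrue-map (isPath K a b) (down ∷_) (allPaths N)))
                 (split a a≤K))
    where
    viaUp : ∀ a → a ≤ K → countTrue (λ ps → isPath K a b (up ∷ ps)) (allPaths N) ≡ C K N (suc a) b
    viaUp a a≤K = countTrue-cong (allPaths N) (λ ps → cong (_∧ ((suc a ≤ᵇ K) ∧ staysAndEnds K (suc a) ps b)) (≤ᵇ-true a≤K))
    split : ∀ a → a ≤ K → countTrue (λ ps → isPath K a b (up ∷ ps)) (allPaths N)
                            ℕ.+ countTrue (λ ps → isPath K a b (down ∷ ps)) (allPaths N)
                          ≡ firstStep (C K N) a b
    split zero    0≤K   = trans (cong₂ ℕ._+_ (viaUp zero 0≤K) (countTrue-false (allPaths N) (λ _ → refl))) (ℕP.+-identityʳ _)
    split (suc a) 1+a≤K = cong₂ ℕ._+_ (viaUp (suc a) 1+a≤K) (countTrue-cong (allPaths N) λ ps →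
      trans (cong (_∧ staysAndEnds K a ps b) (≤ᵇ-true 1+a≤K))
            (sym (cong (_∧ staysAndEnds K a ps b) (≤ᵇ-true (ℕP.<⇒≤ 1+a≤K)))))

  C-suc-lastStep : ∀ N a b → b ≤ K → C K (suc N) a b ≡ lastStep (C K N) a b
  C-suc-lastStep N a b b≤K with ℕP.≤-<-connex a K
  C-suc-lastStep N a b b≤K | inj₂ K<a = trans (C-source-above (suc N) a b K<a) (sym (lastStep-zero b))
    where lastStep-zero : ∀ b → lastStep (C K N) a b ≡ 0
          lastStep-zero zero    = C-source-above N a 1 K<a
          lastStep-zero (suc b) rewrite C-source-above N a (suc (suc b)) K<a | C-source-above N a b K<a = refl
  C-suc-lastStep zero a b b≤K | inj₁ a≤K =
    begin
      C K 1 a b              ≡⟨ C-suc-firstStep 0 a b a≤K ⟩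
      firstStep (C K 0) a b  ≡⟨ firstStep-δ a a≤K ⟩
      firstStep δ a b        ≡⟨ firstStep-δ≡lastStep-δ a b ⟩
      lastStep δ a b         ≡⟨ lastStep-δ b b≤K ⟨
      lastStep (C K 0) a b   ∎
    where
    open ≡-Reasoning
    firstStep-δ : ∀ a → a ≤ K → firstStep (C K 0) a b ≡ firstStep δ a b
    firstStep-δ zero    _ = C-zero-length 1 b (inj₂ b≤K)
    firstStep-δ (suc a) _ = cong₂ ℕ._+_ (C-zero-length (suc (suc a)) b (inj₂ b≤K)) (C-zero-length a b (inj₂ b≤K))
    lastStep-δ : ∀ b → b ≤ K → lastStep (C K 0) a b ≡ lastStep δ a b
    lastStep-δ zero    _ = C-zero-length a 1 (inj₁ a≤K)
    lastStep-δ (suc b) _ = cong₂ ℕ._+_ (C-zero-length a (suc (suc b)) (inj₁ a≤K)) (C-zero-length a b (inj₁ a≤K))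
  C-suc-lastStep (suc N) a b b≤K | inj₁ a≤K =
    begin
      C K (suc (suc N)) a b                ≡⟨ C-suc-firstStep (suc N) a b a≤K ⟩
      firstStep (C K (suc N)) a b          ≡⟨ firstStep-IH a ⟩
      firstStep (lastStep (C K N)) a b     ≡⟨ firstStep-lastStep-comm (C K N) a b ⟩
      lastStep (firstStep (C K N)) a b     ≡⟨ lastStep-firstStep b ⟨
      lastStep (C K (suc N)) a b           ∎
    where
    open ≡-Reasoning
    firstStep-IH : ∀ a → firstStep (C K (suc N)) a b ≡ firstStep (lastStep (C K N)) a b
    firstStep-IH zero    = C-suc-lastStep N 1 b b≤K
    firstStep-IH (suc a) = cong₂ ℕ._+_ (C-suc-lastStep N (suc (suc a)) b b≤K) (C-suc-lastStep N a b b≤K)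
    lastStep-firstStep : ∀ b → lastStep (C K (suc N)) a b ≡ lastStep (firstStep (C K N)) a b
    lastStep-firstStep zero    = C-suc-firstStep N a 1 a≤K
    lastStep-firstStep (suc b) = cong₂ ℕ._+_ (C-suc-firstStep N a (suc (suc b)) a≤K) (C-suc-firstStep N a b a≤K)

pos-∸-+ : ∀ {d} j → j ≤ d → + d ≡ + (d ∸ j) + + j
pos-∸-+ {d} j j≤d = trans (cong +_ (sym (ℕP.m∸n+n≡m j≤d))) (ℤP.pos-+ (d ∸ j) j)

Sequence : Set
Sequence = ℤ → ℤ

_⊛_ : ∀ {d} → (Fin (suc d) → ℤ) → Sequence → Sequence
_⊛_ {d} q e N = Σℤ (suc d) (λ i → q i * e (N - + toℕ i))

Recurrent : Sequence → Set
Recurrent e = Σ ℕ λ d → Σ (Fin (suc d) → ℤ) λ q → q (fromℕ d) ≢ + 0 × (∀ N → (q ⊛ e) N ≡ + 0)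

VanishesFrom : Sequence → ℤ → Set
VanishesFrom e T = ∀ n → e (T + + n) ≡ + 0

module _ {d : ℕ} (q : Fin (suc d) → ℤ) where

  ⊛-cong : ∀ {e e′} → (∀ N → e N ≡ e′ N) → ∀ N → (q ⊛ e) N ≡ (q ⊛ e′) N
  ⊛-cong e≗e′ N = Σℤ-cong (suc d) (λ i → cong (q i *_) (e≗e′ (N - + toℕ i)))

  ⊛-+ : ∀ e e′ N → (q ⊛ (λ M → e M + e′ M)) N ≡ (q ⊛ e) N + (q ⊛ e′) N
  ⊛-+ e e′ N = trans (Σℤ-cong (suc d) (λ i → ℤP.*-distribˡ-+ (q i) (e (N - + toℕ i)) (e′ (N - + toℕ i))))
                     (Σℤ-distrib-+ (suc d) (λ i → q i * e (N - + toℕ i)) (λ i → q i * e′ (N - + toℕ i)))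

  ⊛-zero : ∀ {e} → (∀ N → e N ≡ + 0) → ∀ N → (q ⊛ e) N ≡ + 0
  ⊛-zero e≗0 N = Σℤ-zero (suc d) (λ i → trans (cong (q i *_) (e≗0 (N - + toℕ i))) (ℤP.*-zeroʳ (q i)))

  ⊛-comm : ∀ {d′} (q′ : Fin (suc d′) → ℤ) e N → (q ⊛ (q′ ⊛ e)) N ≡ (q′ ⊛ (q ⊛ e)) N
  ⊛-comm {d′} q′ e N =
    begin
      Σℤ (suc d) (λ i → q i * Σℤ (suc d′) (λ j → q′ j * e (N - + toℕ i - + toℕ j)))
        ≡⟨ Σℤ-cong (suc d) (λ i → sym (Σℤ-*ˡ (suc d′) (q i) (λ j → q′ j * e (N - + toℕ i - + toℕ j)))) ⟩
      Σℤ (suc d) (λ i → Σℤ (suc d′) (λ j → q i * (q′ j * e (N - + toℕ i - + toℕ j))))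
        ≡⟨ Σℤ-swap (suc d) (suc d′) (λ i j → q i * (q′ j * e (N - + toℕ i - + toℕ j))) ⟩
      Σℤ (suc d′) (λ j → Σℤ (suc d) (λ i → q i * (q′ j * e (N - + toℕ i - + toℕ j))))
        ≡⟨ Σℤ-cong (suc d′) (λ j → Σℤ-cong (suc d) (λ i → reorder i j)) ⟩
      Σℤ (suc d′) (λ j → Σℤ (suc d) (λ i → q′ j * (q i * e (N - + toℕ j - + toℕ i))))
        ≡⟨ Σℤ-cong (suc d′) (λ j → Σℤ-*ˡ (suc d) (q′ j) (λ i → q i * e (N - + toℕ j - + toℕ i))) ⟩
      Σℤ (suc d′) (λ j → q′ j * Σℤ (suc d) (λ i → q i * e (N - + toℕ j - + toℕ i)))
        ∎
    where
    open ≡-Reasoning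
    reorder : ∀ i j → q i * (q′ j * e (N - + toℕ i - + toℕ j)) ≡ q′ j * (q i * e (N - + toℕ j - + toℕ i))
    reorder i j = trans (cong (λ M → q i * (q′ j * e M)) (swap-shifts N (+ toℕ i) (+ toℕ j)))
                        (swap-factors (q i) (q′ j) (e (N - + toℕ j - + toℕ i)))
      where swap-shifts : ∀ N a b → N - a - b ≡ N - b - a
            swap-shifts = solve-∀
            swap-factors : ∀ a b c → a * (b * c) ≡ b * (a * c)
            swap-factors = solve-∀

  ⊛-vanishesFrom : ∀ {e} T → VanishesFrom e T → VanishesFrom (q ⊛ e) (T + + d)
  ⊛-vanishesFrom {e} T e≗0 n = Σℤ-zero (suc d) λ i →
    trans (cong (λ M → q i * e M) (shift i))
          (trans (cong (q i *_) (e≗0 (d ∸ toℕ i ℕ.+ n))) (ℤP.*-zeroʳ (q i)))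
    where
    shift : ∀ (i : Fin (suc d)) → T + + d + + n - + toℕ i ≡ T + + (d ∸ toℕ i ℕ.+ n)
    shift i =
      trans (cong (λ D → T + D + + n - + toℕ i) (pos-∸-+ (toℕ i) (ℕP.≤-pred (toℕ<n i))))
            (trans (regroup T (+ (d ∸ toℕ i)) (+ toℕ i) (+ n)) (cong (λ D → T + D) (sym (ℤP.pos-+ (d ∸ toℕ i) n))))
      where regroup : ∀ T a b n → T + (a + b) + n - b ≡ T + (a + n)
            regroup = solve-∀


n≡m+[n-m] : ∀ n m → n ≡ m + (n - m)
n≡m+[n-m] = solve-∀

module _ {d : ℕ} (q : Fin (suc d) → ℤ) (q-leading : q (fromℕ d) ≢ + 0) {e : Sequence} (q⊛e≗0 : ∀ N → (q ⊛ e) N ≡ + 0) where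

  -- At N = U + d the recurrence expresses e U through e (U + 1), …, e (U + d).
  vanishesFrom-pred : ∀ U → VanishesFrom e (U + + 1) → VanishesFrom e U
  vanishesFrom-pred U e≗0 zero    with ℤP.i*j≡0⇒i≡0∨j≡0 (q (fromℕ d)) leading-term
    where
    later-terms : Σℤ d (λ i → q (inject₁ i) * e (U + + d - + toℕ (inject₁ i))) ≡ + 0
    later-terms = Σℤ-zero d λ i →
      trans (cong (λ M → q (inject₁ i) * e M) (shift i))
            (trans (cong (q (inject₁ i) *_) (e≗0 (d ∸ suc (toℕ i)))) (ℤP.*-zeroʳ (q (inject₁ i))))
      where
      shift : ∀ (i : Fin d) → U + + d - + toℕ (inject₁ i) ≡ U + + 1 + + (d ∸ suc (toℕ i))
      shift i rewrite toℕ-inject₁ i =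
        trans (cong (λ D → U + D - + toℕ i)
                    (trans (pos-∸-+ (suc (toℕ i)) (toℕ<n i)) (cong (λ D → + (d ∸ suc (toℕ i)) + D) (ℤP.pos-+ 1 (toℕ i)))))
              (regroup U (+ (d ∸ suc (toℕ i))) (+ toℕ i))
        where regroup : ∀ U a b → U + (a + (+ 1 + b)) - b ≡ U + + 1 + a
              regroup = solve-∀
    leading-term : q (fromℕ d) * e U ≡ + 0
    leading-term =
      begin
        q (fromℕ d) * e U                                          ≡⟨ cong (λ M → q (fromℕ d) * e M) (sym at-U) ⟩
        q (fromℕ d) * e (U + + d - + toℕ (fromℕ d))                ≡⟨ ℤP.+-identityˡ _ ⟨
        + 0 + q (fromℕ d) * e (U + + d - + toℕ (fromℕ d))          ≡⟨ cong (_+ q (fromℕ d) * e (U + + d - + toℕ (fromℕ d))) later-terms ⟨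
        Σℤ d (λ i → q (inject₁ i) * e (U + + d - + toℕ (inject₁ i)))
          + q (fromℕ d) * e (U + + d - + toℕ (fromℕ d))            ≡⟨ Σℤ-last d (λ i → q i * e (U + + d - + toℕ i)) ⟨
        (q ⊛ e) (U + + d)                                          ≡⟨ q⊛e≗0 (U + + d) ⟩
        + 0                                                        ∎
      where
      open ≡-Reasoning
      at-U : U + + d - + toℕ (fromℕ d) ≡ U
      at-U rewrite toℕ-fromℕ d = cancel U (+ d)
        where cancel : ∀ U D → U + D - D ≡ U
              cancel = solve-∀
  ... | inj₁ q-leading≡0 = ⊥-elim (q-leading q-leading≡0)
  ... | inj₂ eU≡0        = trans (cong e (ℤP.+-identityʳ U)) eU≡0
  vanishesFrom-pred U e≗0 (suc n) = trans (cong e (regroup U (+ n))) (e≗0 n)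
    where regroup : ∀ U n → U + (+ 1 + n) ≡ U + + 1 + n
          regroup = solve-∀

  vanishesFrom-minus : ∀ T t → VanishesFrom e T → VanishesFrom e (T - + t)
  vanishesFrom-minus T zero    e≗0 n = trans (cong (λ M → e (M + + n)) (ℤP.+-identityʳ T)) (e≗0 n)
  vanishesFrom-minus T (suc t) e≗0 = vanishesFrom-pred (T - + suc t) λ n →
    trans (cong (λ M → e (M + + n)) (regroup T (+ t))) (vanishesFrom-minus T t e≗0 n)
    where regroup : ∀ T t → T - (+ 1 + t) + + 1 ≡ T - t
          regroup = solve-∀

  -- A recurrence with non-zero leading coefficient can be run backwards.
  vanishesFrom⇒vanishes : ∀ T → VanishesFrom e T → ∀ N → e N ≡ + 0
  vanishesFrom⇒vanishes T e≗0 N with N - T in N-T≡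
  ... | + n      = trans (cong e (trans (n≡m+[n-m] N T) (cong (λ D → T + D) N-T≡))) (e≗0 n)
  ... | -[1+ n ] = trans (cong e (trans (n≡m+[n-m] N T) (trans (cong (λ D → T + D) N-T≡) (sym (ℤP.+-identityʳ _)))))
                         (vanishesFrom-minus T (suc n) e≗0 0)

-- The composite q₁ ⊛ q₂ ⊛ q₃ annihilates the sum, which is then run backwards three times.
recurrent-sum₃-vanishes : ∀ {e₁ e₂ e₃} → Recurrent e₁ → Recurrent e₂ → Recurrent e₃ →
                          VanishesFrom (λ N → e₁ N + e₂ N + e₃ N) (+ 0) → ∀ N → e₁ N + e₂ N + e₃ N ≡ + 0
recurrent-sum₃-vanishes {e₁} {e₂} {e₃} (d₁ , q₁ , q₁-leading , q₁⊛e₁≗0) (d₂ , q₂ , q₂-leading , q₂⊛e₂≗0)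
                                        (d₃ , q₃ , q₃-leading , q₃⊛e₃≗0) e≗0 =
  vanishesFrom⇒vanishes q₃ q₃-leading q₃⊛e≗0 (+ 0) e≗0
  where
  e : Sequence
  e N = e₁ N + e₂ N + e₃ N
  q₃⊛e≗q₃⊛[e₁+e₂] : ∀ N → (q₃ ⊛ e) N ≡ (q₃ ⊛ e₁) N + (q₃ ⊛ e₂) N
  q₃⊛e≗q₃⊛[e₁+e₂] N = trans (⊛-+ q₃ (λ M → e₁ M + e₂ M) e₃ N)
                             (trans (cong₂ _+_ (⊛-+ q₃ e₁ e₂ N) (q₃⊛e₃≗0 N)) (ℤP.+-identityʳ _))
  q₂⊛q₃⊛e≗q₂⊛q₃⊛e₁ : ∀ N → (q₂ ⊛ (q₃ ⊛ e)) N ≡ (q₂ ⊛ (q₃ ⊛ e₁)) N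
  q₂⊛q₃⊛e≗q₂⊛q₃⊛e₁ N =
    trans (⊛-cong q₂ q₃⊛e≗q₃⊛[e₁+e₂] N)
          (trans (⊛-+ q₂ (q₃ ⊛ e₁) (q₃ ⊛ e₂) N)
                 (trans (cong (λ x → (q₂ ⊛ (q₃ ⊛ e₁)) N + x) (trans (⊛-comm q₂ q₃ e₂ N) (⊛-zero q₃ q₂⊛e₂≗0 N)))
                        (ℤP.+-identityʳ _)))
  q₁⊛q₂⊛q₃⊛e≗0 : ∀ N → (q₁ ⊛ (q₂ ⊛ (q₃ ⊛ e))) N ≡ + 0
  q₁⊛q₂⊛q₃⊛e≗0 N =
    trans (⊛-cong q₁ q₂⊛q₃⊛e≗q₂⊛q₃⊛e₁ N)
          (trans (⊛-comm q₁ q₂ (q₃ ⊛ e₁) N)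
                 (⊛-zero q₂ (λ M → trans (⊛-comm q₁ q₃ e₁ M) (⊛-zero q₃ q₁⊛e₁≗0 M)) N))
  q₂⊛q₃⊛e≗0 : ∀ N → (q₂ ⊛ (q₃ ⊛ e)) N ≡ + 0
  q₂⊛q₃⊛e≗0 = vanishesFrom⇒vanishes q₁ q₁-leading q₁⊛q₂⊛q₃⊛e≗0 (+ 0 + + d₃ + + d₂)
                (⊛-vanishesFrom q₂ {q₃ ⊛ e} (+ 0 + + d₃) (⊛-vanishesFrom q₃ {e} (+ 0) e≗0))
  q₃⊛e≗0 : ∀ N → (q₃ ⊛ e) N ≡ + 0
  q₃⊛e≗0 = vanishesFrom⇒vanishes q₂ q₂-leading q₂⊛q₃⊛e≗0 (+ 0 + + d₃) (⊛-vanishesFrom q₃ {e} (+ 0) e≗0)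

recurrent-shift : ∀ {e} → Recurrent e → Recurrent (λ N → e (N + + 1))
recurrent-shift {e} (d , q , q-leading , q⊛e≗0) = d , q , q-leading , λ N →
  trans (Σℤ-cong (suc d) (λ i → cong (λ M → q i * e M) (shift-comm N (+ toℕ i)))) (q⊛e≗0 (N + + 1))
  where shift-comm : ∀ N i → N - i + + 1 ≡ N + + 1 - i
        shift-comm = solve-∀

recurrent-neg : ∀ {e} → Recurrent e → Recurrent (λ N → - e N)
recurrent-neg {e} (d , q , q-leading , q⊛e≗0) = d , q , q-leading , λ N →
  trans (Σℤ-cong (suc d) (λ i → pull-sign (q i) (e (N - + toℕ i))))
        (trans (Σℤ-*ˡ (suc d) (- + 1) (λ i → q i * e (N - + toℕ i))) (cong (- + 1 *_) (q⊛e≗0 N)))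
  where pull-sign : ∀ a b → a * - b ≡ - + 1 * (a * b)
        pull-sign = solve-∀

recurrent-zero : Recurrent (λ _ → + 0)
recurrent-zero = 0 , (λ _ → + 1) , (λ ()) , λ _ → refl

recurrent-identity-extends : ∀ f g h → Recurrent f → Recurrent g → Recurrent h →
                             (∀ n → f (+ suc n) ≡ g (+ n) + h (+ n)) → ∀ N → f (N + + 1) ≡ g N + h N
recurrent-identity-extends f g h rf rg rh on-ℕ N =
  difference≡0⇒ {f (N + + 1)} {g N} {h N} (recurrent-sum₃-vanishes {λ M → f (M + + 1)} {λ M → - g M} {λ M → - h M} (recurrent-shift {f} rf) (recurrent-neg {g} rg) (recurrent-neg {h} rh)
                   (λ n → ⇒difference≡0 (trans (cong f (cong +_ (ℕP.+-comm n 1))) (on-ℕ n))) N)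
  where
  ⇒difference≡0 : ∀ {a b c} → a ≡ b + c → a + - b + - c ≡ + 0
  ⇒difference≡0 {b = b} {c} refl = cancel b c
    where cancel : ∀ b c → b + c + - b + - c ≡ + 0
          cancel = solve-∀
  difference≡0⇒ : ∀ {a b c} → a + - b + - c ≡ + 0 → a ≡ b + c
  difference≡0⇒ {a} {b} {c} a-b-c≡0 = trans (expand a b c) (trans (cong (_+ (b + c)) a-b-c≡0) (ℤP.+-identityˡ _))
    where expand : ∀ a b c → a ≡ a + - b + - c + (b + c)
          expand = solve-∀

-suc+1≡- : ∀ n → - + suc n + + 1 ≡ - + n
-suc+1≡- n = trans (cong (λ z → - z + + 1) (ℤP.pos-+ 1 n)) (cancel (+ n))
  where cancel : ∀ x → - (+ 1 + x) + + 1 ≡ - x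
        cancel = solve-∀

evenHeight oddHeight : ℕ → ℕ
evenHeight x = 2 ℕ.* x ∸ 2
oddHeight  y = 2 ℕ.* y ∸ 1

double-suc : ∀ y → 2 ℕ.* suc y ≡ suc (suc (2 ℕ.* y))
double-suc y = cong suc (ℕP.+-suc y (y ℕ.+ 0))

δ-double : ∀ x y → δ (2 ℕ.* x) (2 ℕ.* y) ≡ δ x y
δ-double zero    zero    = refl
δ-double zero    (suc y) = cong (δ 0) (double-suc y)
δ-double (suc x) zero    = cong (λ z → δ z 0) (double-suc x)
δ-double (suc x) (suc y) = trans (cong₂ δ (double-suc x) (double-suc y)) (δ-double x y)

evenHeight-suc : ∀ x → evenHeight (suc x) ≡ 2 ℕ.* x
evenHeight-suc x = cong (_∸ 2) (double-suc x)

oddHeight-suc : ∀ y → oddHeight (suc y) ≡ suc (2 ℕ.* y)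
oddHeight-suc y = cong (_∸ 1) (double-suc y)

module StripGrids (M′ : ℕ) (c : ℕ → ℕ → ℤ → ℤ)
                  (c-ext : (a b : ℕ) → a ≤ 2 ℕ.* suc M′ ∸ 1 → b ≤ 2 ℕ.* suc M′ ∸ 1 →
                           IsExtension (2 ℕ.* suc M′ ∸ 1) a b (c a b)) where

  M K : ℕ
  M = suc M′
  K = oddHeight M

  oddPaths evenPaths : ℕ → Grid
  oddPaths  N x y = + C K N (evenHeight x) (oddHeight y)
  evenPaths N x y = + C K N (evenHeight x) (evenHeight y)

  oddExt evenExt : ℤ → Grid
  oddExt  N x y = c (evenHeight x) (oddHeight y) N
  evenExt N x y = c (evenHeight x) (evenHeight y) N

  double≤K : ∀ {y} → y ≤ M′ → 2 ℕ.* y ≤ K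
  double≤K {y} y≤M′ = subst (2 ℕ.* y ≤_) (sym (oddHeight-suc M′)) (ℕP.m≤n⇒m≤1+n (ℕP.*-monoʳ-≤ 2 y≤M′))

  1+double≤K : ∀ {y} → y ≤ M′ → suc (2 ℕ.* y) ≤ K
  1+double≤K {y} y≤M′ = subst (suc (2 ℕ.* y) ≤_) (sym (oddHeight-suc M′)) (s≤s (ℕP.*-monoʳ-≤ 2 y≤M′))

  evenHeight≤K : ∀ x → x ≤ M′ → evenHeight (suc x) ≤ K
  evenHeight≤K x x≤M′ = subst (_≤ K) (sym (evenHeight-suc x)) (double≤K x≤M′)

  C-lastStep : ∀ N a b → b ≤ K → + C K (suc N) a b ≡ + lastStep (C K N) a b
  C-lastStep N a b b≤K = cong +_ (C-suc-lastStep K N a b b≤K)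

  evenPaths-suc-bottom : ∀ N x → evenPaths (suc N) x 1 ≡ oddPaths N x 1
  evenPaths-suc-bottom N x = C-lastStep N _ 0 z≤n

  evenPaths-suc : ∀ N x y → suc y ≤ M′ →
                  evenPaths (suc N) x (suc (suc y)) ≡ oddPaths N x (suc (suc y)) + oddPaths N x (suc y)
  evenPaths-suc N x y 1+y≤M′ =
    begin
      + C K (suc N) a (evenHeight (suc (suc y)))                ≡⟨ cong (λ b → + C K (suc N) a b) 2+2y≡ ⟩
      + C K (suc N) a (suc (suc (2 ℕ.* y)))                     ≡⟨ C-lastStep N a _ (subst (_≤ K) (double-suc y) (double≤K 1+y≤M′)) ⟩
      + (C K N a (suc (suc (suc (2 ℕ.* y)))) ℕ.+ C K N a (suc (2 ℕ.* y)))
                                                                 ≡⟨ ℤP.pos-+ (C K N a (suc (suc (suc (2 ℕ.* y))))) (C K N a (suc (2 ℕ.* y))) ⟩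
      + C K N a (suc (suc (suc (2 ℕ.* y)))) + + C K N a (suc (2 ℕ.* y))
                                                                 ≡⟨ cong₂ (λ b b′ → + C K N a b + + C K N a b′) 3+2y≡ (oddHeight-suc y) ⟨
      oddPaths N x (suc (suc y)) + oddPaths N x (suc y)         ∎
    where
    open ≡-Reasoning
    a = evenHeight x
    2+2y≡ : evenHeight (suc (suc y)) ≡ suc (suc (2 ℕ.* y))
    2+2y≡ = trans (evenHeight-suc (suc y)) (double-suc y)
    3+2y≡ : oddHeight (suc (suc y)) ≡ suc (suc (suc (2 ℕ.* y)))
    3+2y≡ = trans (oddHeight-suc (suc y)) (cong suc (double-suc y))

  oddPaths-suc : ∀ N x y → y ≤ M′ →
                 oddPaths (suc N) x (suc y) ≡ evenPaths N x (suc (suc y)) + evenPaths N x (suc y)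
  oddPaths-suc N x y y≤M′ =
    begin
      + C K (suc N) a (oddHeight (suc y))                       ≡⟨ cong (λ b → + C K (suc N) a b) (oddHeight-suc y) ⟩
      + C K (suc N) a (suc (2 ℕ.* y))                           ≡⟨ C-lastStep N a _ (1+double≤K y≤M′) ⟩
      + (C K N a (suc (suc (2 ℕ.* y))) ℕ.+ C K N a (2 ℕ.* y))   ≡⟨ ℤP.pos-+ (C K N a (suc (suc (2 ℕ.* y)))) (C K N a (2 ℕ.* y)) ⟩
      + C K N a (suc (suc (2 ℕ.* y))) + + C K N a (2 ℕ.* y)
                                                                 ≡⟨ cong₂ (λ b b′ → + C K N a b + + C K N a b′) 2+2y≡ (evenHeight-suc y) ⟨
      evenPaths N x (suc (suc y)) + evenPaths N x (suc y)       ∎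
    where
    open ≡-Reasoning
    a = evenHeight x
    2+2y≡ : evenHeight (suc (suc y)) ≡ suc (suc (2 ℕ.* y))
    2+2y≡ = trans (evenHeight-suc (suc y)) (double-suc y)

  evenPaths-beyond : ∀ N x → evenPaths N x (suc M) ≡ + 0
  evenPaths-beyond N x rewrite evenHeight-suc M | double-suc M′ =
    cong +_ (C-target-above K N _ _ (subst (_< suc (suc (2 ℕ.* M′))) (sym (oddHeight-suc M′)) (ℕP.n<1+n _)))

  identity≈evenPaths : AgreeOn M identityGrid (evenPaths 0)
  identity≈evenPaths zero     _        (() , _) _
  identity≈evenPaths (suc x) zero      _        (() , _)
  identity≈evenPaths (suc x) (suc y) (_ , s≤s x≤M′) _
    rewrite evenHeight-suc x | evenHeight-suc y =
    cong +_ (trans (sym (δ-double x y)) (sym (C-zero-length K (2 ℕ.* x) (2 ℕ.* y) (inj₁ (double≤K x≤M′)))))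

  recurrent-c : ∀ a b → a ≤ K → b ≤ K → Recurrent (c a b)
  recurrent-c a b a≤K b≤K with c-ext a b a≤K b≤K
  ... | _ , d , q , _ , q-leading , q⊛c≗0 = d , q , q-leading , q⊛c≗0

  c-on-ℕ : ∀ a b → a ≤ K → b ≤ K → ∀ n → c a b (+ n) ≡ + C K n a b
  c-on-ℕ a b a≤K b≤K = proj₁ (c-ext a b a≤K b≤K)

  1≤K : 1 ≤ K
  1≤K = subst (1 ≤_) (sym (oddHeight-suc M′)) (s≤s z≤n)

  c-lastStep-bottom : ∀ a → a ≤ K → ∀ N → c a 0 (N + + 1) ≡ c a 1 N + + 0
  c-lastStep-bottom a a≤K = recurrent-identity-extends (c a 0) (c a 1) (λ _ → + 0) (recurrent-c a 0 a≤K z≤n) (recurrent-c a 1 a≤K 1≤K) recurrent-zero λ n →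
    trans (c-on-ℕ a 0 a≤K z≤n (suc n))
          (trans (C-lastStep n a 0 z≤n) (trans (sym (c-on-ℕ a 1 a≤K 1≤K n)) (sym (ℤP.+-identityʳ _))))

  c-lastStep : ∀ a b → a ≤ K → suc (suc b) ≤ K → ∀ N → c a (suc b) (N + + 1) ≡ c a (suc (suc b)) N + c a b N
  c-lastStep a b a≤K 2+b≤K =
    recurrent-identity-extends (c a (suc b)) (c a (suc (suc b))) (c a b) (recurrent-c a (suc b) a≤K 1+b≤K) (recurrent-c a (suc (suc b)) a≤K 2+b≤K) (recurrent-c a b a≤K b≤K) λ n →
      trans (c-on-ℕ a (suc b) a≤K 1+b≤K (suc n))
            (trans (C-lastStep n a (suc b) 1+b≤K)
                   (trans (ℤP.pos-+ (C K n a (suc (suc b))) (C K n a b))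
                          (sym (cong₂ _+_ (c-on-ℕ a (suc (suc b)) a≤K 2+b≤K n) (c-on-ℕ a b a≤K b≤K n)))))
    where 1+b≤K = ℕP.<⇒≤ 2+b≤K
          b≤K = ℕP.<⇒≤ 1+b≤K

  c-lastStep-top : ∀ a → a ≤ K → ∀ N → c a (suc (2 ℕ.* M′)) (N + + 1) ≡ c a (2 ℕ.* M′) N + + 0
  c-lastStep-top a a≤K =
    recurrent-identity-extends (c a (suc (2 ℕ.* M′))) (c a (2 ℕ.* M′)) (λ _ → + 0) (recurrent-c a _ a≤K top≤K) (recurrent-c a _ a≤K (double≤K ℕP.≤-refl)) recurrent-zero λ n →
      trans (c-on-ℕ a _ a≤K top≤K (suc n))
            (trans (C-lastStep n a _ top≤K)
                   (trans (cong (λ z → + (z ℕ.+ C K n a (2 ℕ.* M′)))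
                                (C-target-above K n a _ (subst (_< suc (suc (2 ℕ.* M′))) (sym (oddHeight-suc M′)) (ℕP.n<1+n _))))
                          (trans (sym (c-on-ℕ a _ a≤K (double≤K ℕP.≤-refl) n)) (sym (ℤP.+-identityʳ _)))))
    where top≤K = ℕP.≤-reflexive (sym (oddHeight-suc M′))

  identity≈evenExt : AgreeOn M identityGrid (evenExt (+ 0))
  identity≈evenExt x y x∈ y∈ with x | y | x∈ | y∈
  ... | zero   | _     | () , _ | _
  ... | suc x′ | zero  | _      | () , _
  ... | suc x′ | suc y′ | _ , s≤s x′≤M′ | _ , s≤s y′≤M′ =
    trans (identity≈evenPaths (suc x′) (suc y′) (s≤s z≤n , s≤s x′≤M′) (s≤s z≤n , s≤s y′≤M′))
          (sym (c-on-ℕ _ _ (evenHeight≤K x′ x′≤M′) (evenHeight≤K y′ y′≤M′) 0))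

  rising falling : ColumnOps
  rising  = risingOps M′ 1
  falling = fallingOps M′ 1

  -- Adding to each column its right neighbour is one step of the walk from even to odd heights.
  rising-evenPaths : ∀ N {Y} → AgreeOn M Y (evenPaths N) → AgreeOn M (applyOps rising Y) (oddPaths (suc N))
  rising-evenPaths N Y≈ x zero     _  (() , _)
  rising-evenPaths N {Y} Y≈ x (suc y) x∈ y∈@(_ , s≤s y≤M′) with ℕP.m≤n⇒m<n∨m≡n y≤M′
  ... | inj₁ y<M′ =
    trans (applyOps-rising-inside M′ 1 Y x (suc y) (s≤s z≤n) (s≤s y<M′))
          (trans (cong₂ _+_ (Y≈ x (suc y) x∈ y∈) (Y≈ x (suc (suc y)) x∈ (s≤s z≤n , s≤s y<M′)))
                 (trans (ℤP.+-comm (evenPaths N x (suc y)) (evenPaths N x (suc (suc y)))) (sym (oddPaths-suc N x y y≤M′))))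
  ... | inj₂ refl =
    trans (applyOps-rising-outside M′ 1 Y x (suc y) (inj₂ ℕP.≤-refl))
          (trans (Y≈ x (suc y) x∈ y∈)
                 (sym (trans (oddPaths-suc N x y y≤M′)
                             (trans (cong (_+ evenPaths N x (suc y)) (evenPaths-beyond N x)) (ℤP.+-identityˡ _)))))

  falling-oddPaths : ∀ N {X} → AgreeOn M X (oddPaths N) → AgreeOn M (applyOps falling X) (evenPaths (suc N))
  falling-oddPaths N X≈ x zero          _  (() , _)
  falling-oddPaths N {X} X≈ x (suc zero) x∈ y∈ =
    trans (applyOps-falling-outside M′ 1 X x 1 (inj₁ ℕP.≤-refl))
          (trans (X≈ x 1 x∈ y∈) (sym (evenPaths-suc-bottom N x)))
  falling-oddPaths N {X} X≈ x (suc (suc y)) x∈ y∈@(_ , s≤s 1+y≤M′) =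
    trans (applyOps-falling-inside M′ 1 X x (suc y) (s≤s z≤n) (s≤s 1+y≤M′))
          (trans (cong₂ _+_ (X≈ x (suc (suc y)) x∈ y∈) (X≈ x (suc y) x∈ (s≤s z≤n , ℕP.m≤n⇒m≤1+n 1+y≤M′)))
                 (sym (evenPaths-suc N x y 1+y≤M′)))

  -- The dual operations take steps backwards, which the extension c also satisfies at negative lengths.
  dualRising-evenExt : ∀ N {Q} → AgreeOn M Q (evenExt (N + + 1)) → AgreeOn M (applyDualOps rising Q) (oddExt N)
  dualRising-evenExt N Q≈ zero     _ (() , _) _
  dualRising-evenExt N {Q} Q≈ (suc x) y x∈@(_ , s≤s x≤M′) (1≤y , y≤M) =
    applyDualOps-rising M′ 1 Q (oddExt N) (suc x) bottom step y 1≤y y≤M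
    where
    a≤K = evenHeight≤K x x≤M′
    bottom : Q (suc x) 1 ≡ oddExt N (suc x) 1
    bottom = trans (Q≈ (suc x) 1 x∈ (s≤s z≤n , s≤s z≤n))
                   (trans (c-lastStep-bottom _ a≤K N) (ℤP.+-identityʳ _))
    step : ∀ y → 1 ≤ y → y < 1 ℕ.+ M′ → Q (suc x) (suc y) ≡ oddExt N (suc x) (suc y) + oddExt N (suc x) y
    step (suc y) _ (s≤s y<M′) =
      trans (Q≈ (suc x) (suc (suc y)) x∈ (s≤s z≤n , s≤s y<M′))
            (subst₂ (λ b b′ → evenExt (N + + 1) (suc x) (suc (suc y)) ≡ c (evenHeight (suc x)) b N + c (evenHeight (suc x)) b′ N)
                    (sym (trans (oddHeight-suc (suc y)) (cong suc (double-suc y)))) (sym (oddHeight-suc y))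
                    (trans (cong (λ b → c (evenHeight (suc x)) b (N + + 1)) (trans (evenHeight-suc (suc y)) (double-suc y)))
                           (c-lastStep _ (suc (2 ℕ.* y)) a≤K (subst (_≤ K) (cong suc (double-suc y)) (1+double≤K y<M′)) N)))

  dualFalling-oddExt : ∀ N {X} → AgreeOn M X (oddExt (N + + 1)) → AgreeOn M (applyDualOps falling X) (evenExt N)
  dualFalling-oddExt N X≈ zero     _ (() , _) _
  dualFalling-oddExt N {X} X≈ (suc x) y x∈@(_ , s≤s x≤M′) (1≤y , y≤M) =
    applyDualOps-falling M′ 1 X (evenExt N) (suc x) top step y 1≤y y≤M
    where
    a≤K = evenHeight≤K x x≤M′
    top : X (suc x) (1 ℕ.+ M′) ≡ evenExt N (suc x) (1 ℕ.+ M′)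
    top = trans (X≈ (suc x) (suc M′) x∈ (s≤s z≤n , ℕP.≤-refl))
                (trans (cong (λ b → c (evenHeight (suc x)) b (N + + 1)) (oddHeight-suc M′))
                       (trans (c-lastStep-top _ a≤K N)
                              (trans (ℤP.+-identityʳ _) (cong (λ b → c (evenHeight (suc x)) b N) (sym (evenHeight-suc M′))))))
    step : ∀ y → 1 ≤ y → y < 1 ℕ.+ M′ → X (suc x) y ≡ evenExt N (suc x) y + evenExt N (suc x) (suc y)
    step (suc y) _ (s≤s y<M′) =
      trans (X≈ (suc x) (suc y) x∈ (s≤s z≤n , s≤s (ℕP.<⇒≤ y<M′)))
            (trans (cong (λ b → c (evenHeight (suc x)) b (N + + 1)) (oddHeight-suc y))
                   (trans (c-lastStep _ (2 ℕ.* y) a≤K (subst (_≤ K) (double-suc y) (double≤K y<M′)) N)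
                          (trans (ℤP.+-comm (c (evenHeight (suc x)) (suc (suc (2 ℕ.* y))) N) _)
                                 (cong₂ (λ b b′ → c (evenHeight (suc x)) b N + c (evenHeight (suc x)) b′ N)
                                        (sym (evenHeight-suc y))
                                        (sym (trans (evenHeight-suc (suc y)) (double-suc y)))))))

  alternatingOps : ℕ → ColumnOps
  alternatingOps zero    = rising
  alternatingOps (suc t) = alternatingOps t ++ (falling ++ rising)

  admissible-alternatingOps : ∀ t → Admissible M (alternatingOps t)
  admissible-alternatingOps zero    = admissible-rising M M′ 1 (s≤s z≤n) ℕP.≤-refl
  admissible-alternatingOps (suc t) =
    admissible-++ M (alternatingOps t) _ (admissible-alternatingOps t)
      (admissible-++ M falling rising (admissible-falling M M′ 1 (s≤s z≤n) ℕP.≤-refl) (admissible-rising M M′ 1 (s≤s z≤n) ℕP.≤-refl))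

  alternatingOps-oddPaths : ∀ t → AgreeOn M (applyOps (alternatingOps t) identityGrid) (oddPaths (suc (2 ℕ.* t)))
  alternatingOps-oddPaths zero = rising-evenPaths 0 identity≈evenPaths
  alternatingOps-oddPaths (suc t)
    rewrite applyOps-++ (alternatingOps t) (falling ++ rising) identityGrid
          | applyOps-++ falling rising (applyOps (alternatingOps t) identityGrid) =
    subst (AgreeOn M _) (cong (λ N → oddPaths (suc N)) (sym (double-suc t)))
      (rising-evenPaths (suc (suc (2 ℕ.* t))) (falling-oddPaths (suc (2 ℕ.* t)) (alternatingOps-oddPaths t)))

  alternatingOps-oddExt : ∀ t → AgreeOn M (applyDualOps (alternatingOps t) identityGrid) (oddExt (- + suc (2 ℕ.* t)))
  alternatingOps-oddExt zero = dualRising-evenExt (- + 1) identity≈evenExt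
  alternatingOps-oddExt (suc t)
    rewrite applyDualOps-++ (alternatingOps t) (falling ++ rising) identityGrid
          | applyDualOps-++ falling rising (applyDualOps (alternatingOps t) identityGrid) =
    subst (AgreeOn M _) (cong (λ N → oddExt (- + suc N)) (sym (double-suc t))) $
    dualRising-evenExt (- + suc (suc (suc (2 ℕ.* t))))
      (subst (AgreeOn M _) (cong evenExt (sym (-suc+1≡- (suc (suc (2 ℕ.* t))))))
        (dualFalling-oddExt (- + suc (suc (2 ℕ.* t)))
          (subst (AgreeOn M _) (cong oddExt (sym (-suc+1≡- (suc (2 ℕ.* t))))) (alternatingOps-oddExt t))))

  complementaryMinors-oddPaths : ∀ {k m} → k ℕ.+ m ≡ M → ∀ t →
    ComplementaryMinors k m (oddPaths (oddHeight (suc t))) (oddExt (- + oddHeight (suc t)))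
  complementaryMinors-oddPaths {k} {m} k+m≡M t =
    subst₂ (ComplementaryMinors k m) (cong oddPaths (sym (oddHeight-suc t))) (cong (λ N → oddExt (- + N)) (sym (oddHeight-suc t)))
      (complementaryMinors-agreeOn
        (subst (λ M → AgreeOn M (applyOps ops identityGrid) (oddPaths (suc (2 ℕ.* t)))) (sym k+m≡M) (alternatingOps-oddPaths t))
        (subst (λ M → AgreeOn M (applyDualOps ops identityGrid) (oddExt (- + suc (2 ℕ.* t)))) (sym k+m≡M) (alternatingOps-oddExt t))
        (complementaryMinors-applyOps ops
          (subst (λ M → Admissible M ops) (sym k+m≡M) (admissible-alternatingOps t))
          complementaryMinors-identityGrid))
    where ops = alternatingOps t

theorem24 : (n k m : ℕ) → 1 ≤ n → 1 ≤ k → 1 ≤ m →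
    (r s : Fin k → ℕ) → StrictlyIncreasing r → StrictlyIncreasing s →
    ((i : Fin k) → 1 ≤ r i × r i ≤ k ℕ.+ m) →
    ((i : Fin k) → 1 ≤ s i × s i ≤ k ℕ.+ m) →
    (rb sb : Fin m → ℕ) → StrictlyIncreasing rb → StrictlyIncreasing sb →
    ((x : ℕ) → (Σ (Fin m) (λ j → rb j ≡ x)) ⇔ ((1 ≤ x × x ≤ k ℕ.+ m) × ¬ Σ (Fin k) (λ i → r i ≡ x))) →
    ((x : ℕ) → (Σ (Fin m) (λ j → sb j ≡ x)) ⇔ ((1 ≤ x × x ≤ k ℕ.+ m) × ¬ Σ (Fin k) (λ i → s i ≡ x))) →
    (c : ℕ → ℕ → ℤ → ℤ) →
    ((a b : ℕ) → a ≤ 2 ℕ.* (k ℕ.+ m) ∸ 1 → b ≤ 2 ℕ.* (k ℕ.+ m) ∸ 1 →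
      IsExtension (2 ℕ.* (k ℕ.+ m) ∸ 1) a b (c a b)) →
    det k (λ i j → + C (2 ℕ.* (k ℕ.+ m) ∸ 1) (2 ℕ.* n ∸ 1) (2 ℕ.* r i ∸ 2) (2 ℕ.* s j ∸ 1))
      ≡ ((- + 1) ℤ.^ Σℕ m (λ i → rb i ℕ.+ sb i)) ℤ.*
        det m (λ i j → c (2 ℕ.* rb i ∸ 2) (2 ℕ.* sb j ∸ 1) (- + (2 ℕ.* n ∸ 1)))
theorem24 (suc t) (suc k′) m _ _ _ r s r↑ s↑ r∈ s∈ r̄ s̄ r̄↑ s̄↑ r̄-complement s̄-complement c c-ext =
  StripGrids.complementaryMinors-oddPaths (k′ ℕ.+ m) c c-ext refl t
    (record { increasing = r↑ ; increasinḡ = r̄↑ ; inRange = r∈ ; complement = r̄-complement })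
    (record { increasing = s↑ ; increasinḡ = s̄↑ ; inRange = s∈ ; complement = s̄-complement })
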